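{- Let $m\ge3$ and $N=2^m+1$. The substitution $\eta_N$ on the alphabet $\mathcal{A}_m$ is primitive.
   Context: The Thue-Morse substitution is $\theta(0)=01$, $\theta(1)=10$. $\mathcal{A}_m$ is the set of subwords of length $N=2^m+1$ of the Thue-Morse sequence $0110100110010110\dots$ ($|\mathcal{A}_m|=3\cdot2^m$), listed lexicographically (with $0<1$) as $w_1<\dots<w_{|\mathcal{A}_m|}$; it is partitioned into $\mathcal{Q}_k=\{w_j:(k-1)\tfrac14|\mathcal{A}_m|<j\le k\tfrac14|\mathcal{A}_m|\}$, $k=1,2,3,4$. The $N$-block substitution $\theta_N$ on $\mathcal{A}_m$ is: for $b\in\mathcal{A}_m$ with $\theta(b)=v_1\dots v_{2N}$, $\theta_N(b)=(v_1\dots v_N)(v_2\dots v_{N+1})$. Write $\theta_N(w_i)=w_{F(i)}w_{G(i)}$, and let $\tau(j)=\big((j-1+\tfrac12|\mathcal{A}_m|)\bmod|\mathcal{A}_m|\big)+1$ on indices. The substitution $\eta_N$ on $\mathcal{A}_m$ is defined by $\eta_N(w_i)=\theta_N(w_i)$ for even $i$, and for odd $i$: $\eta_N(w_i)=w_{G(i)}$ if $w_i\in\mathcal{Q}_1$; $\eta_N(w_i)=w_{F(i)}$ if $w_i\in\mathcal{Q}_2$; $\eta_N(w_i)=\theta_N(w_i)\,w_{F(\tau(i))}$ (three letters) if $w_i\in\mathcal{Q}_3$; $\eta_N(w_i)=w_{G(\tau(i))}\,\theta_N(w_i)$ (three letters) if $w_i\in\mathcal{Q}_4$. A substitution is primitive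 if some power of its incidence matrix (entry $(b,b')$ = number of occurrences of $b$ in the image of $b'$) has all entries positive. -}

module Defs where

open import Data.Bool using (Bool; true; false; not; if_then_else_; _∧_)
open import Data.Nat using (ℕ; zero; suc; _+_; _*_; _^_; _<_; _≤_; _≡ᵇ_; _<ᵇ_; _≤ᵇ_)
open import Data.Nat.DivMod using (_/_; _%_)
open import Data.Fin using (Fin; toℕ)
open import Data.List using (List; []; _∷_; length; take; drop; concatMap; applyUpTo; allFin; map; filter)
open import Data.Nat.ListAction using (sum)
open import Data.List.Properties using (≡-dec)
open import Data.List.Membership.Propositional using (_∈_)
open import Data.List.Relation.Unary.Linked using (Linked)
open import Data.Product using (Σ; ∃; _×_)
open import Relation.Nullary using (does)
open import Relation.Binary.PropositionalEquality using (_≡_)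
import Data.Bool as B
import Data.Nat as N

-- Words over {0,1}; 0 is `false`, 1 is `true`.

Word : Set
Word = List Bool

-- Thue–Morse sequence: t(n) = parity of the binary digit sum of n,
-- i.e. t(2n) = t(n), t(2n+1) = not t(n), t(0) = 0.
-- Computed with fuel; fuel n suffices since n halves at each step and t(0)=0.
tmFuel : ℕ → ℕ → Bool
tmFuel zero    n = false
tmFuel (suc f) n = if (n % 2) ≡ᵇ 1 then not (tmFuel f (n / 2)) else tmFuel f (n / 2)

tm : ℕ → Bool
tm n = tmFuel n n

factor : ℕ → ℕ → Word
factor i n = applyUpTo (λ k → tm (i + k)) n

blockLen : ℕ → ℕ
blockLen m = 2 ^ m + 1

IsFactor : ℕ → Word → Set
IsFactor m w = ∃ λ i → w ≡ factor i (blockLen m)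

data _<lex_ : Word → Word → Set where
  halt  : ∀ {b v} → [] <lex (b ∷ v)
  here  : ∀ {u v} → (false ∷ u) <lex (true ∷ v)
  there : ∀ {b u v} → u <lex v → (b ∷ u) <lex (b ∷ v)

IsLexListing : ℕ → List Word → Set
IsLexListing m ws =
  Linked _<lex_ ws × (∀ w → (w ∈ ws → IsFactor m w) × (IsFactor m w → w ∈ ws))

θ : Word → Word
θ = concatMap (λ b → b ∷ not b ∷ [])

_==w_ : Word → Word → Bool
u ==w v = does (≡-dec B._≟_ u v)

-- 0-based position of a word in a list (length of the list if absent)
indexOf : List Word → Word → ℕ
indexOf []       w = 0
indexOf (x ∷ xs) w = if x ==w w then 0 else suc (indexOf xs w)

-- 0-based access (default [] out of range)
at : List Word → ℕ → Word
at []       _       = []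
at (x ∷ xs) zero    = x
at (x ∷ xs) (suc j) = at xs j

modN : ℕ → ℕ → ℕ
modN a zero    = a
modN a (suc n) = a % suc n

module Eta (m : ℕ) (ws : List Word) where
  Nm : ℕ
  Nm = blockLen m

  L : ℕ
  L = length ws

  -- All indices below are 0-based: position j corresponds to the paper's
  -- index i = j + 1, i.e. w_i = at ws j.

  -- θ_N(w_i) = w_{F(i)} w_{G(i)}
  F G : ℕ → ℕ
  F j = indexOf ws (take Nm (θ (at ws j)))
  G j = indexOf ws (take Nm (drop 1 (θ (at ws j))))

  -- τ(i) = ((i - 1 + |A|/2) mod |A|) + 1, in 0-based form
  τ : ℕ → ℕ
  τ j = modN (j + L / 2) L

  -- w_i ∈ Q_k  iff  (k-1)|A|/4 < i ≤ k|A|/4, with i = j+1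
  inQ : ℕ → ℕ → Bool
  inQ k j = (N._∸_ k 1 * L <ᵇ 4 * suc j) ∧ (4 * suc j ≤ᵇ k * L)

  -- i = j+1 even
  iEven : ℕ → Bool
  iEven j = (suc j % 2) ≡ᵇ 0

  η : ℕ → List ℕ
  η j =
    if iEven j then F j ∷ G j ∷ [] else
    if inQ 1 j then G j ∷ [] else
    if inQ 2 j then F j ∷ [] else
    if inQ 3 j then F j ∷ G j ∷ F (τ j) ∷ [] else
    if inQ 4 j then G (τ j) ∷ F j ∷ G j ∷ [] else []

Matrix : ℕ → Set
Matrix n = Fin n → Fin n → ℕ

occ : ℕ → List ℕ → ℕ
occ b xs = length (filter (λ x → b N.≟ x) xs)

incidence : (n : ℕ) → (ℕ → List ℕ) → Matrix n
incidence n σ b b' = occ (toℕ b) (σ (toℕ b'))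

_⊗_ : ∀ {n} → Matrix n → Matrix n → Matrix n
_⊗_ {n} A B i j = sum (map (λ k → A i k * B k j) (allFin n))

-- pow A k = A^(k+1)
pow : ∀ {n} → Matrix n → ℕ → Matrix n
pow A zero    = A
pow A (suc k) = A ⊗ pow A k

Primitive : ∀ {n} → Matrix n → Set
Primitive M = ∃ λ k → ∀ i j → 0 < pow M k i j

etaMatrix : (m : ℕ) (ws : List Word) → Matrix (length ws)
etaMatrix m ws = incidence (length ws) (Eta.η m ws)

module Submission where

-- Write m = k + 2 and c = 3·2^k, so the alphabet has 4c letters.
--  1. Factors.  The factors of length 2n+1 are the words θ(w) minus the last or
--     the first letter, for the factors w of length n+1.  This yields an explicit
--     recursive `listing`, shown sorted and complete, hence equal to the given
--     lexicographic listing.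
--  2. Positions.  The prefix of length 2^{k+1}+1 of the j-th word is the ⌊j/2⌋-th
--     word one level down; so (0-based) F(j) = c + ⌊j/2⌋, G(j) = 3c + ⌊j/2⌋ mod 4c.
--  3. Reading off the definition of η_N, the substitution graph has the edges
--     j → F(j) and j → G(j), except for some even j (`Edges`).
--  4. General criterion: a substitution is primitive if some letter h lies in its
--     own image, is reached from every letter and reaches every letter.
--  5. Dynamics.  h = 2c − 1 is fixed by F and reached from every letter.  In the
--     coordinate Y(x) = x + 2c + 1 mod 4c each letter has a predecessor with double
--     Y, and since 4c = 3·2^m, m backward steps end at one of three letters that h
--     reaches.

open import Defs
open import Data.Bool using (Bool; true; false; not; if_then_else_; T; _∧_)
open import Data.Bool.Properties using (∧-zeroʳ)
import Data.Bool as B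
open import Data.Unit using (tt)
open import Data.Nat using (ℕ; zero; suc; _+_; _*_; _^_; _∸_; _<_; _≤_; _⊔_; _≡ᵇ_; _<ᵇ_; _≤ᵇ_; z≤n; s≤s; s≤s⁻¹; ⌊_/2⌋; _<?_; NonZero)
import Data.Nat as N
open import Data.Nat.Properties
open import Data.Nat.DivMod
open import Data.Nat.Induction using (<-wellFounded)
open import Data.Nat.ListAction using (sum)
open import Data.Nat.Tactic.RingSolver using (solve-∀)
open import Induction.WellFounded using (Acc; acc)
open import Data.Fin using (Fin; toℕ; fromℕ<)
open import Data.Fin.Properties using (toℕ<n; toℕ-fromℕ<)
open import Data.List using (List; []; _∷_; applyUpTo; map; _++_; length; take; drop; filter)
open import Data.List.Properties using (≡-dec; map-∘; map-cong; map-++; length-map; length-++; ++-assoc; length-applyUpTo)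
open import Data.List.Membership.Propositional using (_∈_)
open import Data.List.Membership.Propositional.Properties using (∈-map⁺; ∈-map⁻; ∈-++⁺ˡ; ∈-++⁺ʳ; ∈-++⁻; ∈-allFin; ∈-filter⁺)
open import Data.List.Membership.DecPropositional (≡-dec B._≟_) using (_∈?_)
open import Data.List.Relation.Unary.Any using (here; there)
open import Data.List.Relation.Unary.All as All using (All; []; _∷_)
import Data.List.Relation.Unary.All.Properties as All
open import Data.List.Relation.Unary.AllPairs as AllPairs using (AllPairs; []; _∷_)
import Data.List.Relation.Unary.AllPairs.Properties as AllPairs
open import Data.List.Relation.Unary.Linked.Properties using (Linked⇒AllPairs)
open import Data.Product using (Σ; _×_; _,_; proj₁; proj₂)
open import Data.Sum using (_⊎_; inj₁; inj₂)
open import Data.Empty using (⊥; ⊥-elim)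
open import Relation.Nullary using (¬_; yes; no)
open import Relation.Nullary.Decidable using (toWitness; dec-true; dec-false)
open import Relation.Binary.PropositionalEquality

-- The fuel of `tmFuel` is irrelevant once it exceeds the argument, since the
-- argument halves at each step; this lets `tm` be unfolded one binary digit.
tmFuel-zero : ∀ f → tmFuel f 0 ≡ false
tmFuel-zero zero    = refl
tmFuel-zero (suc f) = tmFuel-zero f

half≤pred : ∀ n → suc n / 2 ≤ n
half≤pred n = ≤-pred (m/n<m (suc n) 2 ≤-refl)

tmFuel-stable : ∀ f g n → n ≤ f → n ≤ g → tmFuel f n ≡ tmFuel g n
tmFuel-stable f       g       zero    _       _       = trans (tmFuel-zero f) (sym (tmFuel-zero g))
tmFuel-stable (suc f) (suc g) (suc n) (s≤s p) (s≤s q) =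
  cong (λ b → if (suc n % 2) ≡ᵇ 1 then not b else b)
       (tmFuel-stable f g (suc n / 2) (≤-trans (half≤pred n) p) (≤-trans (half≤pred n) q))

tm-unfold : ∀ n → tm n ≡ (if (n % 2) ≡ᵇ 1 then not (tm (n / 2)) else tm (n / 2))
tm-unfold zero    = refl
tm-unfold (suc n) = cong (λ b → if (suc n % 2) ≡ᵇ 1 then not b else b)
                         (tmFuel-stable n (suc n / 2) (suc n / 2) (half≤pred n) ≤-refl)

tm-digit : ∀ n q r → n % 2 ≡ r → n / 2 ≡ q → tm n ≡ (if r ≡ᵇ 1 then not (tm q) else tm q)
tm-digit n q r n%2 n/2 =
  trans (tm-unfold n) (cong₂ (λ r q → if r ≡ᵇ 1 then not (tm q) else tm q) n%2 n/2)

double≡*2 : ∀ i → i + i ≡ i * 2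
double≡*2 i = trans (cong (i +_) (sym (+-identityʳ i))) (*-comm 2 i)

tm-double : ∀ i → tm (i + i) ≡ tm i
tm-double i = subst (λ n → tm n ≡ tm i) (sym (double≡*2 i))
                    (tm-digit (i * 2) i 0 (m*n%n≡0 i 2) (m*n/n≡m i 2))

tm-doubleSuc : ∀ i → tm (suc (i + i)) ≡ not (tm i)
tm-doubleSuc i = subst (λ n → tm (suc n) ≡ not (tm i)) (sym (double≡*2 i))
                       (tm-digit (1 + i * 2) i 1 ([m+kn]%n≡m%n 1 i 2) half)
  where
    half : (1 + i * 2) / 2 ≡ i
    half = trans (+-distrib-/ 1 (i * 2) (subst (λ x → 1 + x < 2) (sym (m*n%n≡0 i 2)) ≤-refl))
                 (m*n/n≡m i 2)

-- θ(w) without its last letter, and θ(w) without its first letter.  A factor of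
-- length 2n+1 starting at an even (odd) position is the `initθ` (`tailθ`) of the
-- factor of length n+1 starting at half that position.
initθ-after : Bool → Word → Word
initθ-after a []      = []
initθ-after a (b ∷ r) = not a ∷ b ∷ initθ-after b r

initθ : Word → Word
initθ []      = []
initθ (a ∷ r) = a ∷ initθ-after a r

tailθ : Word → Word
tailθ []      = []
tailθ (a ∷ r) = not a ∷ θ r

factor-suc : ∀ i n → factor i (suc n) ≡ tm i ∷ factor (suc i) n
factor-suc i n = cong₂ _∷_ (cong tm (+-identityʳ i)) (applyUpTo-cong (λ k → cong tm (+-suc i k)))
  where
    applyUpTo-cong : ∀ {f g : ℕ → Bool} {n} → (∀ k → f k ≡ g k) → applyUpTo f n ≡ applyUpTo g n
    applyUpTo-cong {n = zero}  e = refl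
    applyUpTo-cong {n = suc n} e = cong₂ _∷_ (e 0) (applyUpTo-cong (λ k → e (suc k)))

factor-pair : ∀ i n → factor (i + i) (suc (suc n)) ≡ tm i ∷ not (tm i) ∷ factor (suc i + suc i) n
factor-pair i n = begin
  factor (i + i) (suc (suc n))                              ≡⟨ factor-suc (i + i) (suc n) ⟩
  tm (i + i) ∷ factor (suc (i + i)) (suc n)                 ≡⟨ cong (tm (i + i) ∷_) (factor-suc (suc (i + i)) n) ⟩
  tm (i + i) ∷ tm (suc (i + i)) ∷ factor (suc (suc (i + i))) n
    ≡⟨ cong₂ (λ a b → a ∷ b ∷ factor (suc (suc (i + i))) n) (tm-double i) (tm-doubleSuc i) ⟩
  tm i ∷ not (tm i) ∷ factor (suc (suc (i + i))) n          ≡⟨ cong (λ j → tm i ∷ not (tm i) ∷ factor j n) (sym (+-suc (suc i) i)) ⟩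
  tm i ∷ not (tm i) ∷ factor (suc i + suc i) n              ∎
  where open ≡-Reasoning

θ-factor : ∀ n i → θ (factor i n) ≡ factor (i + i) (n + n)
θ-factor zero    i = refl
θ-factor (suc n) i = begin
  θ (factor i (suc n))                                    ≡⟨ cong θ (factor-suc i n) ⟩
  tm i ∷ not (tm i) ∷ θ (factor (suc i) n)                ≡⟨ cong (λ w → tm i ∷ not (tm i) ∷ w) (θ-factor n (suc i)) ⟩
  tm i ∷ not (tm i) ∷ factor (suc i + suc i) (n + n)      ≡⟨ sym (factor-pair i (n + n)) ⟩
  factor (i + i) (suc (suc (n + n)))                      ≡⟨ cong (factor (i + i)) (cong suc (sym (+-suc n n))) ⟩
  factor (i + i) (suc n + suc n)                          ∎
  where open ≡-Reasoning

initθ-after-factor : ∀ n i → initθ-after (tm i) (factor (suc i) n) ≡ factor (suc (i + i)) (n + n)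
initθ-after-factor zero    i = refl
initθ-after-factor (suc n) i = begin
  initθ-after (tm i) (factor (suc i) (suc n))
    ≡⟨ cong (initθ-after (tm i)) (factor-suc (suc i) n) ⟩
  not (tm i) ∷ tm (suc i) ∷ initθ-after (tm (suc i)) (factor (suc (suc i)) n)
    ≡⟨ cong (λ w → not (tm i) ∷ tm (suc i) ∷ w) (initθ-after-factor n (suc i)) ⟩
  not (tm i) ∷ tm (suc i) ∷ factor (suc (suc i + suc i)) (n + n)
    ≡⟨ sym (factor-pair′ i (n + n)) ⟩
  factor (suc (i + i)) (suc (suc (n + n)))
    ≡⟨ cong (factor (suc (i + i))) (cong suc (sym (+-suc n n))) ⟩
  factor (suc (i + i)) (suc n + suc n) ∎
  where
    open ≡-Reasoning
    factor-pair′ : ∀ i n → factor (suc (i + i)) (suc (suc n))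
                         ≡ not (tm i) ∷ tm (suc i) ∷ factor (suc (suc i + suc i)) n
    factor-pair′ i n = begin
      factor (suc (i + i)) (suc (suc n))          ≡⟨ factor-suc (suc (i + i)) (suc n) ⟩
      tm (suc (i + i)) ∷ factor (suc (suc (i + i))) (suc n)
        ≡⟨ cong₂ (λ a j → a ∷ factor j (suc n)) (tm-doubleSuc i) (sym (+-suc (suc i) i)) ⟩
      not (tm i) ∷ factor (suc i + suc i) (suc n) ≡⟨ cong (not (tm i) ∷_) (factor-suc (suc i + suc i) n) ⟩
      not (tm i) ∷ tm (suc i + suc i) ∷ factor (suc (suc i + suc i)) n
        ≡⟨ cong (λ a → not (tm i) ∷ a ∷ factor (suc (suc i + suc i)) n) (tm-double (suc i)) ⟩
      not (tm i) ∷ tm (suc i) ∷ factor (suc (suc i + suc i)) n ∎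

initθ-factor : ∀ n i → initθ (factor i (suc n)) ≡ factor (i + i) (suc (n + n))
initθ-factor n i = begin
  initθ (factor i (suc n))                         ≡⟨ cong initθ (factor-suc i n) ⟩
  tm i ∷ initθ-after (tm i) (factor (suc i) n)     ≡⟨ cong₂ _∷_ (sym (tm-double i)) (initθ-after-factor n i) ⟩
  tm (i + i) ∷ factor (suc (i + i)) (n + n)        ≡⟨ sym (factor-suc (i + i) (n + n)) ⟩
  factor (i + i) (suc (n + n))                     ∎
  where open ≡-Reasoning

tailθ-factor : ∀ n i → tailθ (factor i (suc n)) ≡ factor (suc (i + i)) (suc (n + n))
tailθ-factor n i = begin
  tailθ (factor i (suc n))                         ≡⟨ cong tailθ (factor-suc i n) ⟩
  not (tm i) ∷ θ (factor (suc i) n)                ≡⟨ cong₂ _∷_ (sym (tm-doubleSuc i)) (θ-factor n (suc i)) ⟩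
  tm (suc (i + i)) ∷ factor (suc i + suc i) (n + n) ≡⟨ cong (λ j → tm (suc (i + i)) ∷ factor j (n + n)) (+-suc (suc i) i) ⟩
  tm (suc (i + i)) ∷ factor (suc (suc (i + i))) (n + n) ≡⟨ sym (factor-suc (suc (i + i)) (n + n)) ⟩
  factor (suc (i + i)) (suc (n + n))               ∎
  where open ≡-Reasoning

blockLen-suc : ∀ k → blockLen k ≡ suc (2 ^ k)
blockLen-suc k = +-comm (2 ^ k) 1

blockLen-double : ∀ k → blockLen (suc k) ≡ suc (2 ^ k + 2 ^ k)
blockLen-double k = trans (blockLen-suc (suc k)) (cong (λ x → suc (2 ^ k + x)) (+-identityʳ (2 ^ k)))

parity : ∀ i → Σ ℕ (λ q → i ≡ q + q ⊎ i ≡ suc (q + q))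
parity zero    = 0 , inj₁ refl
parity (suc i) with parity i
... | q , inj₁ e = q , inj₂ (cong suc e)
... | q , inj₂ e = suc q , inj₁ (cong suc (trans e (sym (+-suc q q))))

initθ-block : ∀ k q → initθ (factor q (blockLen k)) ≡ factor (q + q) (blockLen (suc k))
initθ-block k q rewrite blockLen-suc k | blockLen-double k = initθ-factor (2 ^ k) q

tailθ-block : ∀ k q → tailθ (factor q (blockLen k)) ≡ factor (suc (q + q)) (blockLen (suc k))
tailθ-block k q rewrite blockLen-suc k | blockLen-double k = tailθ-factor (2 ^ k) q

initθ-isFactor : ∀ k p → IsFactor k p → IsFactor (suc k) (initθ p)
initθ-isFactor k p (q , refl) = q + q , initθ-block k q

tailθ-isFactor : ∀ k p → IsFactor k p → IsFactor (suc k) (tailθ p)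
tailθ-isFactor k p (q , refl) = suc (q + q) , tailθ-block k q

isFactor-suc : ∀ k w → IsFactor (suc k) w →
               Σ Word (λ p → IsFactor k p × (w ≡ initθ p ⊎ w ≡ tailθ p))
isFactor-suc k w (i , refl) with parity i
... | q , inj₁ refl = factor q (blockLen k) , (q , refl) , inj₁ (sym (initθ-block k q))
... | q , inj₂ refl = factor q (blockLen k) , (q , refl) , inj₂ (sym (tailθ-block k q))

-- The factors of length N_{k+1} = 2^{k+1}+1 beginning with 0 (`start0 k`) and with
-- 1 (`start1 k`), each in lexicographic order; `listing k` lists all of them.
-- The recursion follows the doubling θ: at the next level, the words beginning
-- with 0 are the tailθ of those beginning with 1, then the initθ of those
-- beginning with 0, and symmetrically.
mutual
  start0 : ℕ → List Word
  start0 zero    = (false ∷ false ∷ true ∷ []) ∷ (false ∷ true ∷ false ∷ []) ∷ (false ∷ true ∷ true ∷ []) ∷ []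
  start0 (suc k) = map tailθ (start1 k) ++ map initθ (start0 k)

  start1 : ℕ → List Word
  start1 zero    = (true ∷ false ∷ false ∷ []) ∷ (true ∷ false ∷ true ∷ []) ∷ (true ∷ true ∷ false ∷ []) ∷ []
  start1 (suc k) = map initθ (start1 k) ++ map tailθ (start0 k)

listing : ℕ → List Word
listing k = start0 k ++ start1 k

listing₀-sound : All (IsFactor 1) (listing 0)
listing₀-sound = (5 , refl) ∷ (3 , refl) ∷ (0 , refl) ∷ (4 , refl) ∷ (2 , refl) ∷ (1 , refl) ∷ []

listing₀-complete : ∀ a b → initθ (a ∷ b ∷ []) ∈ listing 0 × tailθ (a ∷ b ∷ []) ∈ listing 0
listing₀-complete false false = toWitness {a? = _ ∈? listing 0} _ , toWitness {a? = _ ∈? listing 0} _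
listing₀-complete false true  = toWitness {a? = _ ∈? listing 0} _ , toWitness {a? = _ ∈? listing 0} _
listing₀-complete true  false = toWitness {a? = _ ∈? listing 0} _ , toWitness {a? = _ ∈? listing 0} _
listing₀-complete true  true  = toWitness {a? = _ ∈? listing 0} _ , toWitness {a? = _ ∈? listing 0} _

listing-suc⁻ : ∀ k w → w ∈ listing (suc k) → Σ Word (λ p → p ∈ listing k × (w ≡ initθ p ⊎ w ≡ tailθ p))
listing-suc⁻ k w w∈ with ∈-++⁻ (start0 (suc k)) w∈
... | inj₁ w∈₀ with ∈-++⁻ (map tailθ (start1 k)) w∈₀
...   | inj₁ w∈J = let p , p∈ , e = ∈-map⁻ tailθ w∈J in p , ∈-++⁺ʳ (start0 k) p∈ , inj₂ e
...   | inj₂ w∈I = let p , p∈ , e = ∈-map⁻ initθ w∈I in p , ∈-++⁺ˡ p∈ , inj₁ e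
listing-suc⁻ k w w∈ | inj₂ w∈₁ with ∈-++⁻ (map initθ (start1 k)) w∈₁
...   | inj₁ w∈I = let p , p∈ , e = ∈-map⁻ initθ w∈I in p , ∈-++⁺ʳ (start0 k) p∈ , inj₁ e
...   | inj₂ w∈J = let p , p∈ , e = ∈-map⁻ tailθ w∈J in p , ∈-++⁺ˡ p∈ , inj₂ e

initθ-∈-listing : ∀ k p → p ∈ listing k → initθ p ∈ listing (suc k)
initθ-∈-listing k p p∈ with ∈-++⁻ (start0 k) p∈
... | inj₁ p∈₀ = ∈-++⁺ˡ (∈-++⁺ʳ (map tailθ (start1 k)) (∈-map⁺ initθ p∈₀))
... | inj₂ p∈₁ = ∈-++⁺ʳ (start0 (suc k)) (∈-++⁺ˡ (∈-map⁺ initθ p∈₁))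

tailθ-∈-listing : ∀ k p → p ∈ listing k → tailθ p ∈ listing (suc k)
tailθ-∈-listing k p p∈ with ∈-++⁻ (start0 k) p∈
... | inj₁ p∈₀ = ∈-++⁺ʳ (start0 (suc k)) (∈-++⁺ʳ (map initθ (start1 k)) (∈-map⁺ tailθ p∈₀))
... | inj₂ p∈₁ = ∈-++⁺ˡ (∈-++⁺ˡ (∈-map⁺ tailθ p∈₁))

listing-sound : ∀ k w → w ∈ listing k → IsFactor (suc k) w
listing-sound zero    w w∈ = All.lookup listing₀-sound w∈
listing-sound (suc k) w w∈ with listing-suc⁻ k w w∈
... | p , p∈ , inj₁ refl = initθ-isFactor (suc k) p (listing-sound k p p∈)
... | p , p∈ , inj₂ refl = tailθ-isFactor (suc k) p (listing-sound k p p∈)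

listing-complete : ∀ k w → IsFactor (suc k) w → w ∈ listing k
listing-complete zero w isF with isFactor-suc 0 w isF
... | p , (i , refl) , inj₁ refl = proj₁ (listing₀-complete (tm (i + 0)) (tm (i + 1)))
... | p , (i , refl) , inj₂ refl = proj₂ (listing₀-complete (tm (i + 0)) (tm (i + 1)))
listing-complete (suc k) w isF with isFactor-suc (suc k) w isF
... | p , p-isF , inj₁ refl = initθ-∈-listing k p (listing-complete k p p-isF)
... | p , p-isF , inj₂ refl = tailθ-∈-listing k p (listing-complete k p p-isF)

lex-trans : ∀ {x y z} → x <lex y → y <lex z → x <lex z
lex-trans halt      here      = halt
lex-trans halt      (there _) = halt
lex-trans here      (there _) = here
lex-trans (there p) here      = here
lex-trans (there p) (there q) = there (lex-trans p q)

lex-irrefl : ∀ {x} → ¬ (x <lex x)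
lex-irrefl (there p) = lex-irrefl p

θ-mono : ∀ {u v} → u <lex v → θ u <lex θ v
θ-mono halt      = halt
θ-mono here      = here
θ-mono (there p) = there (there (θ-mono p))

initθ-mono : ∀ {u v} → u <lex v → initθ u <lex initθ v
initθ-mono halt      = halt
initθ-mono here      = here
initθ-mono (there p) = there (after-mono p)
  where
    after-mono : ∀ {b u v} → u <lex v → initθ-after b u <lex initθ-after b v
    after-mono halt      = halt
    after-mono here      = there here
    after-mono (there p) = there (there (after-mono p))

tailθ-mono : ∀ {a u v} → (a ∷ u) <lex (a ∷ v) → tailθ (a ∷ u) <lex tailθ (a ∷ v)
tailθ-mono (there p) = there (θ-mono p)

-- All words of the listing have this shape, and it is what separates the
-- initθ-images from the tailθ-images in the order.
data Shape (a : Bool) : Word → Set where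
  shape : ∀ {b c r} → ¬ (a ≡ b × b ≡ c) → Shape a (a ∷ b ∷ c ∷ r)

not-fixed : ∀ b → ¬ (b ≡ not b)
not-fixed false ()
not-fixed true  ()

shape-initθ : ∀ {a w} → Shape a w → Shape a (initθ w)
shape-initθ {a} (shape _) = shape (λ (e , _) → not-fixed a e)

shape-tailθ : ∀ {a w} → Shape a w → Shape (not a) (tailθ w)
shape-tailθ (shape {b} _) = shape (λ (_ , e) → not-fixed b e)

tailθ₁<initθ₀ : ∀ {o z} → Shape true o → Shape false z → tailθ o <lex initθ z
tailθ₁<initθ₀ (shape {false} _)              (shape _)         = there here
tailθ₁<initθ₀ (shape {true} {true} ne)       _                 = ⊥-elim (ne (refl , refl))
tailθ₁<initθ₀ (shape {true} {false} _)       (shape {true} _)  = there (there here)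
tailθ₁<initθ₀ (shape {true} {false} _)       (shape {false} _) = there (there (there here))

initθ₁<tailθ₀ : ∀ {o z} → Shape true o → Shape false z → initθ o <lex tailθ z
initθ₁<tailθ₀ (shape _)         (shape {true} _)          = there here
initθ₁<tailθ₀ _                 (shape {false} {false} ne) = ⊥-elim (ne (refl , refl))
initθ₁<tailθ₀ (shape {false} _) (shape {false} {true} _)  = there (there here)
initθ₁<tailθ₀ (shape {true} _)  (shape {false} {true} _)  = there (there (there here))

map-sorted : ∀ {P : Word → Set} {f : Word → Word} →
             (∀ {x y} → P x → P y → x <lex y → f x <lex f y) →
             ∀ {xs} → All P xs → AllPairs _<lex_ xs → AllPairs _<lex_ (map f xs)
map-sorted mono []         []         = []
map-sorted mono (px ∷ pxs) (rx ∷ rxs) =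
  All.map⁺ (All.zipWith (λ (py , r) → mono px py r) (pxs , rx)) ∷ map-sorted mono pxs rxs

blocks-ordered : ∀ {P Q : Word → Set} {f g : Word → Word} →
                 (∀ {x y} → P x → Q y → f x <lex g y) →
                 ∀ {xs ys} → All P xs → All Q ys → All (λ x → All (x <lex_) (map g ys)) (map f xs)
blocks-ordered below ps qs = All.map⁺ (All.map (λ px → All.map⁺ (All.map (below px) qs)) ps)

record Sorted (k : ℕ) : Set where
  field
    shape0  : All (Shape false) (start0 k)
    shape1  : All (Shape true) (start1 k)
    sorted0 : AllPairs _<lex_ (start0 k)
    sorted1 : AllPairs _<lex_ (start1 k)

sortedStarts : ∀ k → Sorted k
sortedStarts zero = record
  { shape0  = shape (λ { (_ , ()) }) ∷ shape (λ { (() , _) }) ∷ shape (λ { (() , _) }) ∷ []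
  ; shape1  = shape (λ { (() , _) }) ∷ shape (λ { (() , _) }) ∷ shape (λ { (_ , ()) }) ∷ []
  ; sorted0 = (there here ∷ there here ∷ []) ∷ (there (there here) ∷ []) ∷ [] ∷ []
  ; sorted1 = (there (there here) ∷ there here ∷ []) ∷ (there here ∷ []) ∷ [] ∷ []
  }
sortedStarts (suc k) = record
  { shape0  = All.++⁺ (All.map⁺ (All.map shape-tailθ shape1)) (All.map⁺ (All.map shape-initθ shape0))
  ; shape1  = All.++⁺ (All.map⁺ (All.map shape-initθ shape1)) (All.map⁺ (All.map shape-tailθ shape0))
  ; sorted0 = AllPairs.++⁺ (map-sorted tailθ-sameHead shape1 sorted1)
                           (map-sorted (λ _ _ → initθ-mono) shape0 sorted0)
                           (blocks-ordered tailθ₁<initθ₀ shape1 shape0)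
  ; sorted1 = AllPairs.++⁺ (map-sorted (λ _ _ → initθ-mono) shape1 sorted1)
                           (map-sorted tailθ-sameHead shape0 sorted0)
                           (blocks-ordered initθ₁<tailθ₀ shape1 shape0)
  }
  where
    open Sorted (sortedStarts k)
    tailθ-sameHead : ∀ {a x y} → Shape a x → Shape a y → x <lex y → tailθ x <lex tailθ y
    tailθ-sameHead (shape _) (shape _) = tailθ-mono

listing-sorted : ∀ k → AllPairs _<lex_ (listing k)
listing-sorted k = AllPairs.++⁺ sorted0 sorted1 (All.map (λ { (shape _) → All.map (λ { (shape _) → here }) shape1 }) shape0)
  where open Sorted (sortedStarts k)

module _ {A : Set} {_<_ : A → A → Set}
         (<-trans : ∀ {x y z} → x < y → y < z → x < z) (<-irrefl : ∀ {x} → ¬ (x < x)) where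

  sorted-unique : ∀ {xs ys} → AllPairs _<_ xs → AllPairs _<_ ys →
                  (∀ w → w ∈ xs → w ∈ ys) → (∀ w → w ∈ ys → w ∈ xs) → xs ≡ ys
  sorted-unique {[]}     {[]}     _ _ _  _  = refl
  sorted-unique {[]}     {y ∷ _}  _ _ _  ys⊆ with ys⊆ y (here refl)
  ... | ()
  sorted-unique {x ∷ _}  {[]}     _ _ xs⊆ _  with xs⊆ x (here refl)
  ... | ()
  sorted-unique {x ∷ xs} {y ∷ ys} (x<xs ∷ sxs) (y<ys ∷ sys) xs⊆ ys⊆ =
    cong₂ _∷_ x≡y (sorted-unique sxs sys (shrink x<xs x≡y xs⊆) (shrink y<ys (sym x≡y) ys⊆))
    where
      x≡y : x ≡ y
      x≡y with xs⊆ x (here refl) | ys⊆ y (here refl)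
      ... | here e     | _          = e
      ... | there _    | here e     = sym e
      ... | there x∈ys | there y∈xs = ⊥-elim (<-irrefl (<-trans (All.lookup x<xs y∈xs) (All.lookup y<ys x∈ys)))
      -- dropping the common head keeps the inclusion, as the head is below every other member
      shrink : ∀ {a b as bs} → All (a <_) as → a ≡ b →
               (∀ w → w ∈ a ∷ as → w ∈ b ∷ bs) → ∀ w → w ∈ as → w ∈ bs
      shrink a<as refl ⊆ w w∈ with ⊆ w (there w∈)
      ... | here refl = ⊥-elim (<-irrefl (All.lookup a<as w∈))
      ... | there w∈′ = w∈′

lexListing≡listing : ∀ k ws → IsLexListing (suc k) ws → ws ≡ listing k
lexListing≡listing k ws (linked , members) =
  sorted-unique lex-trans lex-irrefl (Linked⇒AllPairs lex-trans linked) (listing-sorted k)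
    (λ w w∈ → listing-complete k w (proj₁ (members w) w∈))
    (λ w w∈ → proj₂ (members w) (listing-sound k w w∈))

at-map : ∀ (f : Word → Word) → f [] ≡ [] → ∀ xs q → at (map f xs) q ≡ f (at xs q)
at-map f f[] []       q       = sym f[]
at-map f f[] (x ∷ xs) zero    = refl
at-map f f[] (x ∷ xs) (suc q) = at-map f f[] xs q

at-++ˡ : ∀ xs ys q → q < length xs → at (xs ++ ys) q ≡ at xs q
at-++ˡ (x ∷ xs) ys zero    _       = refl
at-++ˡ (x ∷ xs) ys (suc q) (s≤s p) = at-++ˡ xs ys q p

at-++ʳ : ∀ xs ys q → at (xs ++ ys) (length xs + q) ≡ at ys q
at-++ʳ []       ys q = refl
at-++ʳ (x ∷ xs) ys q = at-++ʳ xs ys q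

at-∈ : ∀ xs q → q < length xs → at xs q ∈ xs
at-∈ (x ∷ xs) zero    _       = here refl
at-∈ (x ∷ xs) (suc q) (s≤s p) = there (at-∈ xs q p)

indexOf-at : ∀ xs q → AllPairs _≢_ xs → q < length xs → indexOf xs (at xs q) ≡ q
indexOf-at (x ∷ xs) zero    _            _       rewrite dec-true (≡-dec B._≟_ x x) refl = refl
indexOf-at (x ∷ xs) (suc q) (x∉xs ∷ dxs) (s≤s p)
  rewrite dec-false (≡-dec B._≟_ x (at xs q)) (All.lookup x∉xs (at-∈ xs q p)) =
  cong suc (indexOf-at xs q dxs p)

double : List Word → List Word
double []       = []
double (x ∷ xs) = x ∷ x ∷ double xs

at-double : ∀ xs j → at (double xs) j ≡ at xs ⌊ j /2⌋
at-double []       j             = refl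
at-double (x ∷ xs) zero          = refl
at-double (x ∷ xs) (suc zero)    = refl
at-double (x ∷ xs) (suc (suc j)) = at-double xs j

double-map : ∀ f xs → double (map f xs) ≡ map f (double xs)
double-map f []       = refl
double-map f (x ∷ xs) = cong (λ r → f x ∷ f x ∷ r) (double-map f xs)

double-++ : ∀ xs ys → double (xs ++ ys) ≡ double xs ++ double ys
double-++ []       ys = refl
double-++ (x ∷ xs) ys = cong (λ r → x ∷ x ∷ r) (double-++ xs ys)

take-θ : ∀ n w → take (n + n) (θ w) ≡ θ (take n w)
take-θ zero    w       = refl
take-θ (suc n) []      = refl
take-θ (suc n) (b ∷ w) rewrite +-suc n n = cong (λ r → b ∷ not b ∷ r) (take-θ n w)

take-initθ : ∀ n w → take (suc (n + n)) (initθ w) ≡ initθ (take (suc n) w)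
take-initθ n []      = refl
take-initθ n (a ∷ w) = cong (a ∷_) (after n a w)
  where
    after : ∀ n a w → take (n + n) (initθ-after a w) ≡ initθ-after a (take n w)
    after zero    a w       = refl
    after (suc n) a []      = refl
    after (suc n) a (b ∷ w) rewrite +-suc n n = cong (λ r → not a ∷ b ∷ r) (after n b w)

take-tailθ : ∀ n w → take (suc (n + n)) (tailθ w) ≡ tailθ (take (suc n) w)
take-tailθ n []      = refl
take-tailθ n (a ∷ w) = cong (not a ∷_) (take-θ n w)

tailθ≡drop-θ : ∀ w → tailθ w ≡ drop 1 (θ w)
tailθ≡drop-θ []      = refl
tailθ≡drop-θ (a ∷ w) = refl

take-θ-long : ∀ n w → n < length w → take (suc (n + n)) (θ w) ≡ initθ (take (suc n) w)
take-θ-long n (a ∷ w) (s≤s n≤) = cong (a ∷_) (after n a w n≤)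
  where
    after : ∀ n a w → n ≤ length w → take (n + n) (not a ∷ θ w) ≡ initθ-after a (take n w)
    after zero    a w       _       = refl
    after (suc n) a (b ∷ w) (s≤s p) rewrite +-suc n n = cong (λ r → not a ∷ b ∷ r) (after n b w p)

map-take-comm : ∀ (f : Word → Word) n → (∀ w → take (suc (n + n)) (f w) ≡ f (take (suc n) w)) →
                ∀ xs → map (take (suc (n + n))) (map f xs) ≡ map f (map (take (suc n)) xs)
map-take-comm f n comm xs = trans (sym (map-∘ xs)) (trans (map-cong comm xs) (map-∘ xs))

2^suc : ∀ k → 2 ^ suc k ≡ 2 ^ k + 2 ^ k
2^suc k = cong (2 ^ k +_) (+-identityʳ (2 ^ k))

prefixes-start : ∀ k → map (take (suc (2 ^ suc k))) (start0 (suc k)) ≡ double (start0 k)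
                     × map (take (suc (2 ^ suc k))) (start1 (suc k)) ≡ double (start1 k)
prefixes-start zero    = refl , refl
prefixes-start (suc k) rewrite 2^suc (suc k) = step tailθ initθ (take-tailθ n) (take-initθ n) (start1 (suc k)) (start0 (suc k)) (proj₂ IH) (proj₁ IH)
                                             , step initθ tailθ (take-initθ n) (take-tailθ n) (start1 (suc k)) (start0 (suc k)) (proj₂ IH) (proj₁ IH)
  where
    n : ℕ
    n = 2 ^ suc k
    IH : map (take (suc n)) (start0 (suc k)) ≡ double (start0 k) × map (take (suc n)) (start1 (suc k)) ≡ double (start1 k)
    IH = prefixes-start k
    step : ∀ f g → (∀ w → take (suc (n + n)) (f w) ≡ f (take (suc n) w)) →
                   (∀ w → take (suc (n + n)) (g w) ≡ g (take (suc n) w)) →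
           ∀ xs ys {xs′ ys′} → map (take (suc n)) xs ≡ double xs′ → map (take (suc n)) ys ≡ double ys′ →
           map (take (suc (n + n))) (map f xs ++ map g ys) ≡ double (map f xs′ ++ map g ys′)
    step f g f-comm g-comm xs ys {xs′} {ys′} xs-pre ys-pre = begin
      map (take (suc (n + n))) (map f xs ++ map g ys)
        ≡⟨ map-++ (take (suc (n + n))) (map f xs) (map g ys) ⟩
      map (take (suc (n + n))) (map f xs) ++ map (take (suc (n + n))) (map g ys)
        ≡⟨ cong₂ _++_ (map-take-comm f n f-comm xs) (map-take-comm g n g-comm ys) ⟩
      map f (map (take (suc n)) xs) ++ map g (map (take (suc n)) ys)
        ≡⟨ cong₂ (λ a b → map f a ++ map g b) xs-pre ys-pre ⟩
      map f (double xs′) ++ map g (double ys′)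
        ≡⟨ sym (cong₂ _++_ (double-map f xs′) (double-map g ys′)) ⟩
      double (map f xs′) ++ double (map g ys′)
        ≡⟨ sym (double-++ (map f xs′) (map g ys′)) ⟩
      double (map f xs′ ++ map g ys′) ∎
      where open ≡-Reasoning

width : ℕ → ℕ
width k = 3 * 2 ^ k

width-suc : ∀ k → width (suc k) ≡ width k + width k
width-suc k = trans (cong (3 *_) (2^suc k)) (*-distribˡ-+ 3 (2 ^ k) (2 ^ k))

start-length : ∀ k → length (start0 k) ≡ width k × length (start1 k) ≡ width k
start-length zero    = refl , refl
start-length (suc k) = block-length tailθ initθ (start1 k) (start0 k) (proj₂ IH) (proj₁ IH)
                     , block-length initθ tailθ (start1 k) (start0 k) (proj₂ IH) (proj₁ IH)
  where
    IH : length (start0 k) ≡ width k × length (start1 k) ≡ width k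
    IH = start-length k
    block-length : ∀ (f g : Word → Word) xs ys → length xs ≡ width k → length ys ≡ width k →
                   length (map f xs ++ map g ys) ≡ width (suc k)
    block-length f g xs ys |xs| |ys| = begin
      length (map f xs ++ map g ys)          ≡⟨ length-++ (map f xs) ⟩
      length (map f xs) + length (map g ys)  ≡⟨ cong₂ _+_ (length-map f xs) (length-map g ys) ⟩
      length xs + length ys                  ≡⟨ cong₂ _+_ |xs| |ys| ⟩
      width k + width k                      ≡⟨ sym (width-suc k) ⟩
      width (suc k)                          ∎
      where open ≡-Reasoning

listing-length : ∀ k → length (listing k) ≡ width k + width k
listing-length k = trans (length-++ (start0 k)) (cong₂ _+_ (proj₁ (start-length k)) (proj₂ (start-length k)))

listing-suc-split : ∀ k → listing (suc k) ≡ map tailθ (start1 k) ++ (map initθ (listing k) ++ map tailθ (start0 k))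
listing-suc-split k = begin
  (map tailθ (start1 k) ++ map initθ (start0 k)) ++ (map initθ (start1 k) ++ map tailθ (start0 k))
    ≡⟨ ++-assoc (map tailθ (start1 k)) (map initθ (start0 k)) _ ⟩
  map tailθ (start1 k) ++ (map initθ (start0 k) ++ (map initθ (start1 k) ++ map tailθ (start0 k)))
    ≡⟨ cong (map tailθ (start1 k) ++_) (sym (++-assoc (map initθ (start0 k)) (map initθ (start1 k)) _)) ⟩
  map tailθ (start1 k) ++ ((map initθ (start0 k) ++ map initθ (start1 k)) ++ map tailθ (start0 k))
    ≡⟨ cong (λ l → map tailθ (start1 k) ++ (l ++ map tailθ (start0 k))) (sym (map-++ initθ (start0 k) (start1 k))) ⟩
  map tailθ (start1 k) ++ (map initθ (listing k) ++ map tailθ (start0 k)) ∎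
  where open ≡-Reasoning

quadruple : ∀ x → 4 * x ≡ (x + x) + (x + x)
quadruple = solve-∀

half-odd : ∀ n → ⌊ suc (n + n) /2⌋ ≡ n
half-odd zero    = refl
half-odd (suc n) rewrite +-suc n n = cong suc (half-odd n)

half-< : ∀ j n → j < n + n → ⌊ j /2⌋ < n
half-< j n j< = subst (suc ⌊ j /2⌋ ≤_) (half-odd n) (⌊n/2⌋-mono (s≤s j<))

module Positions (k : ℕ) where
  c : ℕ
  c = width k

  ws : List Word
  ws = listing (suc k)

  ws-length : length ws ≡ (c + c) + (c + c)
  ws-length = trans (listing-length (suc k)) (cong₂ _+_ (width-suc k) (width-suc k))

  tailθ₁-length : length (map tailθ (start1 k)) ≡ c
  tailθ₁-length = trans (length-map tailθ (start1 k)) (proj₂ (start-length k))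

  initθ-length : length (map initθ (listing k)) ≡ c + c
  initθ-length = trans (length-map initθ (listing k)) (listing-length k)

  at-block₁ : ∀ q → q < c → at ws q ≡ tailθ (at (start1 k) q)
  at-block₁ q q< = begin
    at ws q                              ≡⟨ cong (λ l → at l q) (listing-suc-split k) ⟩
    at (map tailθ (start1 k) ++ _) q     ≡⟨ at-++ˡ (map tailθ (start1 k)) _ q (subst (q <_) (sym tailθ₁-length) q<) ⟩
    at (map tailθ (start1 k)) q          ≡⟨ at-map tailθ refl (start1 k) q ⟩
    tailθ (at (start1 k) q)              ∎
    where open ≡-Reasoning

  at-block₂ : ∀ q → q < c + c → at ws (c + q) ≡ initθ (at (listing k) q)
  at-block₂ q q< = begin
    at ws (c + q)                        ≡⟨ cong₂ at (listing-suc-split k) (cong (_+ q) (sym tailθ₁-length)) ⟩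
    at (map tailθ (start1 k) ++ _) (length (map tailθ (start1 k)) + q) ≡⟨ at-++ʳ (map tailθ (start1 k)) _ q ⟩
    at (map initθ (listing k) ++ _) q    ≡⟨ at-++ˡ (map initθ (listing k)) _ q (subst (q <_) (sym initθ-length) q<) ⟩
    at (map initθ (listing k)) q         ≡⟨ at-map initθ refl (listing k) q ⟩
    initθ (at (listing k) q)             ∎
    where open ≡-Reasoning

  at-block₃ : ∀ q → at ws (c + ((c + c) + q)) ≡ tailθ (at (start0 k) q)
  at-block₃ q = begin
    at ws (c + ((c + c) + q))
      ≡⟨ cong₂ at (listing-suc-split k) (cong₂ (λ a b → a + (b + q)) (sym tailθ₁-length) (sym initθ-length)) ⟩
    at (map tailθ (start1 k) ++ _) (length (map tailθ (start1 k)) + (length (map initθ (listing k)) + q))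
      ≡⟨ at-++ʳ (map tailθ (start1 k)) _ _ ⟩
    at (map initθ (listing k) ++ map tailθ (start0 k)) (length (map initθ (listing k)) + q)
      ≡⟨ at-++ʳ (map initθ (listing k)) _ q ⟩
    at (map tailθ (start0 k)) q          ≡⟨ at-map tailθ refl (start0 k) q ⟩
    tailθ (at (start0 k) q)              ∎
    where open ≡-Reasoning

  prefix-at : ∀ j → take (suc (2 ^ suc k)) (at ws j) ≡ at (listing k) ⌊ j /2⌋
  prefix-at j = begin
    take (suc (2 ^ suc k)) (at ws j)                 ≡⟨ sym (at-map (take (suc (2 ^ suc k))) refl ws j) ⟩
    at (map (take (suc (2 ^ suc k))) ws) j           ≡⟨ cong (λ l → at l j) (map-++ _ (start0 (suc k)) (start1 (suc k))) ⟩
    at (map _ (start0 (suc k)) ++ map _ (start1 (suc k))) j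
      ≡⟨ cong₂ (λ a b → at (a ++ b) j) (proj₁ (prefixes-start k)) (proj₂ (prefixes-start k)) ⟩
    at (double (start0 k) ++ double (start1 k)) j   ≡⟨ cong (λ l → at l j) (sym (double-++ (start0 k) (start1 k))) ⟩
    at (double (listing k)) j                        ≡⟨ at-double (listing k) j ⟩
    at (listing k) ⌊ j /2⌋                           ∎
    where open ≡-Reasoning

  length-at : ∀ j → j < length ws → length (at ws j) ≡ blockLen (suc (suc k))
  length-at j j< with listing-sound (suc k) (at ws j) (at-∈ ws j j<)
  ... | i , e = trans (cong length e) (length-applyUpTo _ _)

  Nm : ℕ
  Nm = blockLen (suc (suc k))

  θ-first : ∀ j → j < length ws → take Nm (θ (at ws j)) ≡ initθ (at (listing k) ⌊ j /2⌋)
  θ-first j j< = begin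
    take Nm (θ (at ws j))                         ≡⟨ cong (λ n → take n (θ (at ws j))) (blockLen-double (suc k)) ⟩
    take (suc (2 ^ suc k + 2 ^ suc k)) (θ (at ws j)) ≡⟨ take-θ-long (2 ^ suc k) (at ws j) long ⟩
    initθ (take (suc (2 ^ suc k)) (at ws j))      ≡⟨ cong initθ (prefix-at j) ⟩
    initθ (at (listing k) ⌊ j /2⌋)                ∎
    where
      open ≡-Reasoning
      long : 2 ^ suc k < length (at ws j)
      long = subst (2 ^ suc k <_) (sym (trans (length-at j j<) (blockLen-double (suc k))))
                   (s≤s (m≤m+n (2 ^ suc k) (2 ^ suc k)))

  θ-second : ∀ j → take Nm (drop 1 (θ (at ws j))) ≡ tailθ (at (listing k) ⌊ j /2⌋)
  θ-second j = begin
    take Nm (drop 1 (θ (at ws j)))               ≡⟨ cong₂ take (blockLen-double (suc k)) (sym (tailθ≡drop-θ (at ws j))) ⟩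
    take (suc (2 ^ suc k + 2 ^ suc k)) (tailθ (at ws j)) ≡⟨ take-tailθ (2 ^ suc k) (at ws j) ⟩
    tailθ (take (suc (2 ^ suc k)) (at ws j))     ≡⟨ cong tailθ (prefix-at j) ⟩
    tailθ (at (listing k) ⌊ j /2⌋)               ∎
    where open ≡-Reasoning

  ws-distinct : AllPairs (λ x y → x ≡ y → ⊥) ws
  ws-distinct = AllPairs.map (λ x<y x≡y → lex-irrefl (subst (_ <lex_) (sym x≡y) x<y)) (listing-sorted (suc k))

  index-at : ∀ p → p < (c + c) + (c + c) → indexOf ws (at ws p) ≡ p
  index-at p p< = indexOf-at ws p ws-distinct (subst (p <_) (sym ws-length) p<)

  open Eta (suc (suc k)) ws using (F; G)

  F-formula : ∀ j → j < length ws → F j ≡ c + ⌊ j /2⌋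
  F-formula j j< = begin
    F j                                      ≡⟨ cong (indexOf ws) (θ-first j j<) ⟩
    indexOf ws (initθ (at (listing k) q))    ≡⟨ cong (indexOf ws) (sym (at-block₂ q q<)) ⟩
    indexOf ws (at ws (c + q))               ≡⟨ index-at (c + q) (≤-trans (+-monoʳ-< c q<) (+-monoˡ-≤ (c + c) (m≤m+n c c))) ⟩
    c + q                                    ∎
    where
      open ≡-Reasoning
      q : ℕ
      q = ⌊ j /2⌋
      q< : q < c + c
      q< = half-< j (c + c) (subst (j <_) ws-length j<)

  G-formula-low : ∀ j → ⌊ j /2⌋ < c → G j ≡ c + ((c + c) + ⌊ j /2⌋)
  G-formula-low j q< = begin
    G j                                      ≡⟨ cong (indexOf ws) (θ-second j) ⟩
    indexOf ws (tailθ (at (listing k) q))    ≡⟨ cong (λ w → indexOf ws (tailθ w)) (at-++ˡ (start0 k) (start1 k) q q<start0) ⟩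
    indexOf ws (tailθ (at (start0 k) q))     ≡⟨ cong (indexOf ws) (sym (at-block₃ q)) ⟩
    indexOf ws (at ws (c + ((c + c) + q)))   ≡⟨ index-at _ bound ⟩
    c + ((c + c) + q)                        ∎
    where
      open ≡-Reasoning
      q : ℕ
      q = ⌊ j /2⌋
      q<start0 : q < length (start0 k)
      q<start0 = subst (q <_) (sym (proj₁ (start-length k))) q<
      bound : c + ((c + c) + q) < (c + c) + (c + c)
      bound = subst (c + ((c + c) + q) <_) (trans (+-comm c ((c + c) + c)) (+-assoc (c + c) c c))
                    (+-monoʳ-< c (+-monoʳ-< (c + c) q<))

  G-formula-high : ∀ j q′ → ⌊ j /2⌋ ≡ c + q′ → q′ < c → G j ≡ q′
  G-formula-high j q′ q≡ q′< = begin
    G j                                          ≡⟨ cong (indexOf ws) (θ-second j) ⟩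
    indexOf ws (tailθ (at (listing k) ⌊ j /2⌋))  ≡⟨ cong (λ p → indexOf ws (tailθ (at (listing k) p))) (trans q≡ (cong (_+ q′) (sym (proj₁ (start-length k))))) ⟩
    indexOf ws (tailθ (at (listing k) (length (start0 k) + q′))) ≡⟨ cong (λ w → indexOf ws (tailθ w)) (at-++ʳ (start0 k) (start1 k) q′) ⟩
    indexOf ws (tailθ (at (start1 k) q′))        ≡⟨ cong (indexOf ws) (sym (at-block₁ q′ q′<)) ⟩
    indexOf ws (at ws q′)                        ≡⟨ index-at q′ (≤-trans q′< (≤-trans (m≤m+n c c) (m≤m+n (c + c) (c + c)))) ⟩
    q′                                           ∎
    where open ≡-Reasoning

Odd : ℕ → Set
Odd v = Σ ℕ (λ q → v ≡ suc (q + q))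

T⇒true : ∀ {b} → T b → b ≡ true
T⇒true {true} _ = refl

¬T⇒false : ∀ {b} → ¬ T b → b ≡ false
¬T⇒false {false} _  = refl
¬T⇒false {true}  ¬t = ⊥-elim (¬t tt)

even-%2 : ∀ q → (q + q) % 2 ≡ 0
even-%2 q = trans (cong (_% 2) (double≡*2 q)) (m*n%n≡0 q 2)

odd-%2 : ∀ q → suc (q + q) % 2 ≡ 1
odd-%2 q = trans (cong (λ n → suc n % 2) (double≡*2 q)) ([m+kn]%n≡m%n 1 q 2)

-- Which letters occur in η_N of the letter at 0-based position j (the paper's
-- index i = j + 1), for an alphabet of 4c letters: the image contains F(j)
-- unless j is even and j < c (odd i in Q₁), and contains G(j) unless j is even
-- and c ≤ j < 2c (odd i in Q₂).
module EtaLetters (m : ℕ) (ws : List Word) (c : ℕ) (L≡ : length ws ≡ 4 * c) where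
  open Eta m ws

  scaled : ∀ n → n * length ws ≡ 4 * (n * c)
  scaled n = trans (cong (n *_) L≡) (trans (sym (*-assoc n 4 c)) (trans (cong (_* c) (*-comm n 4)) (*-assoc 4 n c)))

  inQ-in : ∀ k j → (k ∸ 1) * c ≤ j → j < k * c → inQ k j ≡ true
  inQ-in k j lo hi rewrite scaled (k ∸ 1) | scaled k =
    cong₂ _∧_ (T⇒true (<⇒<ᵇ (*-monoʳ-< 4 (s≤s lo)))) (T⇒true (≤⇒≤ᵇ (*-monoʳ-≤ 4 hi)))

  inQ-out : ∀ k j → k * c ≤ j → inQ k j ≡ false
  inQ-out k j hi = trans (cong (((k ∸ 1) * length ws <ᵇ 4 * suc j) ∧_) upper-fails) (∧-zeroʳ _)
    where
      upper-fails : (4 * suc j ≤ᵇ k * length ws) ≡ false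
      upper-fails = ¬T⇒false λ t → <-irrefl refl
        (≤-<-trans (subst (4 * suc j ≤_) (scaled k) (≤ᵇ⇒≤ _ _ t)) (*-monoʳ-< 4 (s≤s hi)))

  iEven-odd : ∀ q → iEven (suc (q + q)) ≡ true
  iEven-odd q = cong (_≡ᵇ 0) (trans (cong (_% 2) (sym (+-suc (suc q) q))) (even-%2 (suc q)))

  iEven-even : ∀ q → iEven (q + q) ≡ false
  iEven-even q = cong (_≡ᵇ 0) (odd-%2 q)

  η-odd : ∀ q → η (suc (q + q)) ≡ F (suc (q + q)) ∷ G (suc (q + q)) ∷ []
  η-odd q rewrite iEven-odd q = refl

  η-Q₁ : ∀ j → j < c → iEven j ≡ false → η j ≡ G j ∷ []
  η-Q₁ j hi ev rewrite ev | inQ-in 1 j z≤n (subst (j <_) (sym (*-identityˡ c)) hi) = refl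

  η-Q₂ : ∀ j → c ≤ j → j < 2 * c → iEven j ≡ false → η j ≡ F j ∷ []
  η-Q₂ j lo hi ev rewrite ev | inQ-out 1 j (subst (_≤ j) (sym (*-identityˡ c)) lo)
                          | inQ-in 2 j (subst (_≤ j) (sym (*-identityˡ c)) lo) hi = refl

  η-Q₃ : ∀ j → 2 * c ≤ j → j < 3 * c → iEven j ≡ false → η j ≡ F j ∷ G j ∷ F (τ j) ∷ []
  η-Q₃ j lo hi ev rewrite ev | inQ-out 1 j (≤-trans (*-monoˡ-≤ c {1} {2} (s≤s z≤n)) lo) | inQ-out 2 j lo
                            | inQ-in 3 j lo hi = refl

  η-Q₄ : ∀ j → 3 * c ≤ j → j < 4 * c → iEven j ≡ false → η j ≡ G (τ j) ∷ F j ∷ G j ∷ []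
  η-Q₄ j lo hi ev rewrite ev | inQ-out 1 j (≤-trans (*-monoˡ-≤ c {1} {3} (s≤s z≤n)) lo)
                            | inQ-out 2 j (≤-trans (*-monoˡ-≤ c {2} {3} (s≤s (s≤s z≤n))) lo) | inQ-out 3 j lo
                            | inQ-in 4 j lo hi = refl

  2c≡c+c : 2 * c ≡ c + c
  2c≡c+c = cong (c +_) (+-identityʳ c)

  F∈η : ∀ j → j < 4 * c → c ≤ j ⊎ Odd j → F j ∈ η j
  F∈η j j< (inj₂ (q , refl)) rewrite η-odd q = here refl
  F∈η j j< (inj₁ c≤j) with parity j
  ... | q , inj₂ refl rewrite η-odd q = here refl
  ... | q , inj₁ refl with q + q <? 2 * c | q + q <? 3 * c
  ...   | yes j<2c | _        rewrite η-Q₂ (q + q) c≤j j<2c (iEven-even q) = here refl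
  ...   | no j≮2c  | yes j<3c rewrite η-Q₃ (q + q) (≮⇒≥ j≮2c) j<3c (iEven-even q) = here refl
  ...   | no _     | no j≮3c  rewrite η-Q₄ (q + q) (≮⇒≥ j≮3c) j< (iEven-even q) = there (here refl)

  G∈η : ∀ j → j < 4 * c → j < c ⊎ (c + c ≤ j ⊎ Odd j) → G j ∈ η j
  G∈η j j< (inj₂ (inj₂ (q , refl))) rewrite η-odd q = there (here refl)
  G∈η j j< (inj₁ j<c) with parity j
  ... | q , inj₂ refl rewrite η-odd q = there (here refl)
  ... | q , inj₁ refl rewrite η-Q₁ (q + q) j<c (iEven-even q) = here refl
  G∈η j j< (inj₂ (inj₁ 2c≤j)) with parity j
  ... | q , inj₂ refl rewrite η-odd q = there (here refl)
  ... | q , inj₁ refl with q + q <? 3 * c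
  ...   | yes j<3c rewrite η-Q₃ (q + q) (subst (_≤ q + q) (sym 2c≡c+c) 2c≤j) j<3c (iEven-even q) = there (here refl)
  ...   | no j≮3c  rewrite η-Q₄ (q + q) (≮⇒≥ j≮3c) j< (iEven-even q) = there (there (here refl))

module Walks (E : ℕ → ℕ → Set) where

  infixl 5 _▷_
  data Walk : ℕ → ℕ → ℕ → Set where
    []  : ∀ {j} → Walk 0 j j
    _▷_ : ∀ {n j l i} → Walk n j l → E l i → Walk (suc n) j i

  infixr 5 _++ʷ_
  _++ʷ_ : ∀ {n n′ j l i} → Walk n j l → Walk n′ l i → Walk (n + n′) j i
  _++ʷ_ {n} {j = j} w []      = subst (λ k → Walk k j _) (sym (+-identityʳ n)) w
  _++ʷ_ {n} {j = j} {i = i} w (v ▷ e) = subst (λ k → Walk k j i) (sym (+-suc n _)) ((w ++ʷ v) ▷ e)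

  Reach : ℕ → ℕ → Set
  Reach j i = Σ ℕ (λ n → Walk n j i)

  edge : ∀ {j i} → E j i → Reach j i
  edge e = 1 , [] ▷ e

  infixr 4 _then_
  _then_ : ∀ {j l i} → Reach j l → Reach l i → Reach j i
  (n , w) then (n′ , v) = n + n′ , w ++ʷ v

  loops : ∀ {h} → E h h → ∀ n → Walk n h h
  loops ehh zero    = []
  loops ehh (suc n) = loops ehh n ▷ ehh

  pad-end : ∀ {h j l B} → E h h → Walk l j h → l ≤ B → Walk B j h
  pad-end {h} {j} {l} {B} ehh w l≤B = subst (λ k → Walk k j h) (m+[n∸m]≡n l≤B) (w ++ʷ loops ehh (B ∸ l))

  pad-start : ∀ {h i l B} → E h h → Walk l h i → l ≤ B → Walk B h i
  pad-start {h} {i} {l} {B} ehh w l≤B = subst (λ k → Walk k h i) (m∸n+n≡m l≤B) (loops ehh (B ∸ l) ++ʷ w)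

uniform-bound : ∀ {P : ℕ → ℕ → Set} n → (∀ j → j < n → Σ ℕ (P j)) →
                Σ ℕ (λ B → ∀ j → j < n → Σ ℕ (λ l → l ≤ B × P j l))
uniform-bound zero    wit = 0 , λ _ ()
uniform-bound (suc n) wit with uniform-bound n (λ j j< → wit j (m<n⇒m<1+n j<)) | wit n ≤-refl
... | B , bounded | l₀ , p₀ = B ⊔ l₀ , bound
  where
    bound : ∀ j → j < suc n → Σ ℕ _
    bound j j< with m≤n⇒m<n∨m≡n (s≤s⁻¹ j<)
    ... | inj₁ j<n  = let l , l≤ , p = bounded j j<n in l , ≤-trans l≤ (m≤m⊔n B l₀) , p
    ... | inj₂ refl = l₀ , m≤n⊔m B l₀ , p₀

Edge : ℕ → (ℕ → List ℕ) → ℕ → ℕ → Set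
Edge n σ j i = j < n × i ∈ σ j

occ-pos : ∀ b xs → b ∈ xs → 0 < occ b xs
occ-pos b xs b∈ with filter (λ y → b N.≟ y) xs | ∈-filter⁺ (λ y → b N.≟ y) b∈ refl
... | _ ∷ _ | _ = s≤s z≤n

∈⇒≤sum : ∀ {x xs} → x ∈ xs → x ≤ sum xs
∈⇒≤sum {xs = y ∷ ys} (here refl) = m≤m+n y (sum ys)
∈⇒≤sum {xs = y ∷ ys} (there x∈)  = ≤-trans (∈⇒≤sum x∈) (m≤n+m (sum ys) y)

module _ (n : ℕ) (σ : ℕ → List ℕ) where
  open Walks (Edge n σ)

  private
    M = incidence n σ

  -- Entry (i, j) of the (K+1)-th power of the incidence matrix counts the walks of
  -- K+1 edges from j to i, so it is positive as soon as there is one.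
  walk⇒positive : ∀ K (j i : Fin n) → Walk (suc K) (toℕ j) (toℕ i) → 0 < pow M K i j
  walk⇒positive zero    j i ([] ▷ (_ , i∈)) = occ-pos (toℕ i) (σ (toℕ j)) i∈
  walk⇒positive (suc K) j i (w ▷ (l< , i∈)) =
    <-≤-trans (*-mono-< first rest) (∈⇒≤sum (∈-map⁺ (λ k → M i k * pow M K k j) (∈-allFin l)))
    where
      l : Fin n
      l = fromℕ< l<
      first : 0 < M i l
      first = occ-pos (toℕ i) (σ (toℕ l)) (subst (λ x → toℕ i ∈ σ x) (sym (toℕ-fromℕ< l<)) i∈)
      rest : 0 < pow M K l j
      rest = walk⇒positive K j l (subst (Walk (suc K) (toℕ j)) (sym (toℕ-fromℕ< l<)) w)

  -- A substitution is primitive as soon as some letter h occurs in its own image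
  -- and every letter reaches h and is reached from h: walks through h can then be
  -- padded with the loop at h to one common length.
  hub⇒primitive : ∀ h → Edge n σ h h → (∀ j → j < n → Reach j h) → (∀ i → i < n → Reach h i) →
                  Primitive M
  hub⇒primitive h loop to-h from-h with uniform-bound n to-h | uniform-bound n from-h
  ... | B₁ , to-h≤ | B₂ , from-h≤ = B₁ + B₂ , λ i j → walk⇒positive (B₁ + B₂) j i (walk j i)
    where
      walk : ∀ (j i : Fin n) → Walk (suc (B₁ + B₂)) (toℕ j) (toℕ i)
      walk j i with to-h≤ (toℕ j) (toℕ<n j) | from-h≤ (toℕ i) (toℕ<n i)
      ... | l₁ , l₁≤ , w₁ | l₂ , l₂≤ , w₂ = pad-end loop w₁ (m≤n⇒m≤1+n l₁≤) ++ʷ pad-start loop w₂ l₂≤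

half-shift : ∀ p z → ⌊ (p + p) + z /2⌋ ≡ p + ⌊ z /2⌋
half-shift zero    z = refl
half-shift (suc p) z rewrite +-suc p p = cong suc (half-shift p z)

record Edges (c : ℕ) (E : ℕ → ℕ → Set) : Set where
  field
    F-edge      : ∀ v → v < 4 * c → c ≤ v ⊎ Odd v → E v (c + ⌊ v /2⌋)
    G-edge-low  : ∀ v → v < 4 * c → v < c ⊎ (c + c ≤ v ⊎ Odd v) → ⌊ v /2⌋ < c →
                  E v (c + ((c + c) + ⌊ v /2⌋))
    G-edge-high : ∀ v q → v < 4 * c → v < c ⊎ (c + c ≤ v ⊎ Odd v) → ⌊ v /2⌋ ≡ c + q → E v q

-- Every letter reaches the letter h = 2c − 1, which is a fixed point of F.
module ToHub (c c′ : ℕ) (c≡ : c ≡ suc c′) (2≤c : 2 ≤ c) (E : ℕ → ℕ → Set) (edges : Edges c E) where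
  open Edges edges
  open Walks E

  h : ℕ
  h = c + c′

  4c≡ : 4 * c ≡ (c + c) + (c + c)
  4c≡ = quadruple c

  c+c≡1+h : c + c ≡ suc h
  c+c≡1+h = trans (cong (c +_) c≡) (+-suc c c′)

  below-4c : ∀ {v} → v < c + c + (c + c) → v < 4 * c
  below-4c {v} = subst (v <_) (sym 4c≡)

  high-below-4c : ∀ z → z < c + c → (c + c) + z < 4 * c
  high-below-4c z z< = below-4c (+-monoʳ-< (c + c) z<)

  h<c+c : h < c + c
  h<c+c = subst (h <_) (sym c+c≡1+h) ≤-refl

  half-h : ⌊ h /2⌋ ≡ c′
  half-h = subst (λ x → ⌊ x + c′ /2⌋ ≡ c′) (sym c≡) (half-odd c′)

  hub-loop : E h h
  hub-loop = subst (E h) (cong (c +_) half-h) (F-edge h (below-4c (≤-trans h<c+c (m≤m+n (c + c) (c + c))))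
                                                     (inj₁ (m≤m+n c c′)))

  -- On [c, h], F increases strictly until it reaches h.
  F-climbs : ∀ v → v < h → suc v ≤ c + ⌊ v /2⌋
  F-climbs v v<h = begin
    suc v                           ≡⟨ cong suc (sym (⌊n/2⌋+⌈n/2⌉≡n v)) ⟩
    suc (⌊ v /2⌋ + ⌊ suc v /2⌋)     ≤⟨ s≤s (+-monoʳ-≤ ⌊ v /2⌋ (subst (⌊ suc v /2⌋ ≤_) half-h (⌊n/2⌋-mono v<h))) ⟩
    suc (⌊ v /2⌋ + c′)              ≡⟨ cong suc (+-comm ⌊ v /2⌋ c′) ⟩
    suc c′ + ⌊ v /2⌋                ≡⟨ cong (_+ ⌊ v /2⌋) (sym c≡) ⟩
    c + ⌊ v /2⌋                     ∎
    where open ≤-Reasoning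

  climb : ∀ n v → c ≤ v → v ≤ h → h ≤ v + n → Reach v h
  climb zero    v _   v≤h h≤v = 0 , subst (Walk 0 v) (≤-antisym v≤h (subst (h ≤_) (+-identityʳ v) h≤v)) []
  climb (suc n) v c≤v v≤h h≤v+n =
    edge (F-edge v (below-4c (≤-trans (s≤s v≤h) (≤-trans h<c+c (m≤m+n (c + c) (c + c))))) (inj₁ c≤v))
      then climb n v′ (m≤m+n c _) v′≤h h≤v′+n
    where
      v′ : ℕ
      v′ = c + ⌊ v /2⌋
      v′≤h : v′ ≤ h
      v′≤h = +-monoʳ-≤ c (subst (⌊ v /2⌋ ≤_) half-h (⌊n/2⌋-mono v≤h))
      h≤v′+n : h ≤ v′ + n
      h≤v′+n with m≤n⇒m<n∨m≡n v≤h
      ... | inj₁ v<h  = ≤-trans (subst (h ≤_) (+-suc v n) h≤v+n) (+-monoˡ-≤ n (F-climbs v v<h))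
      ... | inj₂ refl = subst (λ x → h ≤ x + n) (sym (cong (c +_) half-h)) (m≤m+n h n)

  mid-to-hub : ∀ v → c ≤ v → v < c + c → Reach v h
  mid-to-hub v c≤v v< = climb h v c≤v (s≤s⁻¹ (subst (suc v ≤_) c+c≡1+h v<)) (m≤n+m h v)

  one-to-hub : Reach 1 h
  one-to-hub = edge (F-edge 1 (below-4c (≤-trans 2≤c (≤-trans (m≤m+n c c) (m≤m+n (c + c) (c + c)))))
                             (inj₂ (0 , refl)))
               then mid-to-hub (c + 0) (m≤m+n c 0) (+-monoʳ-< c (≤-trans (s≤s z≤n) 2≤c))

  G-down : ∀ z q → z < c + c → ⌊ z /2⌋ ≡ q → Reach ((c + c) + z) q
  G-down z q z< half≡q =
    edge (G-edge-high ((c + c) + z) q (high-below-4c z z<) (inj₂ (inj₁ (m≤m+n (c + c) z)))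
                      (trans (half-shift c z) (cong (c +_) half≡q)))

  -- Above 2c, F halves the distance to 2c, until G leads down to the letter 1.
  descend : ∀ z → Acc _<_ z → 2 ≤ z → z < c + c → Reach ((c + c) + z) 1
  descend (suc zero)                _        (s≤s ()) _
  descend (suc (suc zero))          _        _ z< = G-down 2 1 z< refl
  descend (suc (suc (suc zero)))    _        _ z< = G-down 3 1 z< refl
  descend z@(suc (suc (suc (suc w)))) (acc rs) _ z< =
    edge (subst (E v) shift (F-edge v (high-below-4c z z<) (inj₁ (≤-trans (m≤m+n c c) (m≤m+n (c + c) z)))))
      then descend ⌊ z /2⌋ (rs (⌊n/2⌋<n (suc (suc (suc w))))) (s≤s (s≤s z≤n)) (<-trans (⌊n/2⌋<n _) z<)
    where
      v : ℕ
      v = (c + c) + z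
      shift : c + ⌊ v /2⌋ ≡ (c + c) + ⌊ z /2⌋
      shift = trans (cong (c +_) (half-shift c z)) (sym (+-assoc c c ⌊ z /2⌋))

  descend-to-one : ∀ z → 2 ≤ z → z < c + c → Reach ((c + c) + z) 1
  descend-to-one z = descend z (<-wellFounded z)

  -- Below c, one step of F (odd letters) or G (even letters) leads into [c, h] or above 2c.
  low-to-hub : ∀ j → j < c → Reach j h
  low-to-hub j j<c with parity j
  ... | q , inj₂ refl =
    edge (F-edge j (below-4c (≤-trans j<c (≤-trans (m≤m+n c c) (m≤m+n (c + c) (c + c))))) (inj₂ (q , refl)))
      then mid-to-hub (c + ⌊ j /2⌋) (m≤m+n c _) (+-monoʳ-< c (≤-<-trans (⌊n/2⌋≤n j) j<c))
  ... | q , inj₁ refl =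
    edge (subst (E j) regroup (G-edge-low j (below-4c (≤-trans j<c (≤-trans (m≤m+n c c) (m≤m+n (c + c) (c + c)))))
                                          (inj₁ j<c) q<c))
      then descend-to-one (c + ⌊ j /2⌋) (≤-trans 2≤c (m≤m+n c _)) (+-monoʳ-< c q<c)
      then one-to-hub
    where
      q<c : ⌊ j /2⌋ < c
      q<c = ≤-<-trans (⌊n/2⌋≤n j) j<c
      regroup : c + ((c + c) + ⌊ j /2⌋) ≡ (c + c) + (c + ⌊ j /2⌋)
      regroup = swap c ⌊ j /2⌋ where
        swap : ∀ x y → x + ((x + x) + y) ≡ (x + x) + (x + y)
        swap = solve-∀

  to-hub : ∀ j → j < 4 * c → Reach j h
  to-hub j j< with j <? c | j <? c + c
  ... | yes j<c | _      = low-to-hub j j<c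
  ... | no j≮c  | yes j<2c = mid-to-hub j (≮⇒≥ j≮c) j<2c
  ... | no _    | no j≮2c  = high (j ∸ (c + c)) (sym (m+[n∸m]≡n (≮⇒≥ j≮2c)))
    where
      z< : ∀ z → j ≡ (c + c) + z → z < c + c
      z< z refl = +-cancelˡ-< (c + c) z (c + c) (subst (j <_) 4c≡ j<)
      high : ∀ z → j ≡ (c + c) + z → Reach j h
      high (suc (suc z)) refl = descend-to-one (suc (suc z)) (s≤s (s≤s z≤n)) (z< _ refl) then one-to-hub
      high zero          refl = G-down 0 0 (z< 0 refl) refl then low-to-hub 0 (≤-trans (s≤s z≤n) 2≤c)
      high (suc zero)    refl = G-down 1 0 (z< 1 refl) refl then low-to-hub 0 (≤-trans (s≤s z≤n) 2≤c)

double-mod : ∀ x N .{{_ : NonZero N}} → (2 * (x % N)) % N ≡ (2 * x) % N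
double-mod x N = trans (%-distribˡ-* 2 (x % N) N)
                       (trans (cong (λ r → ((2 % N) * r) % N) (m%n%n≡m%n x N)) (sym (%-distribˡ-* 2 x N)))

pred-multiple : ∀ n → suc n % 3 ≡ 1 → n % 3 ≡ 0
pred-multiple n e = trans (cong (_% 3) n≡) (m*n%n≡0 (suc n / 3) 3)
  where
    n≡ : n ≡ (suc n / 3) * 3
    n≡ = suc-injective (trans (m≡m%n+[m/n]*n (suc n) 3) (cong (_+ (suc n / 3) * 3) e))

pow2-mod3 : ∀ a → 2 ^ a % 3 ≡ 1 ⊎ 2 ^ a % 3 ≡ 2
pow2-mod3 zero = inj₁ refl
pow2-mod3 (suc a) with pow2-mod3 a
... | inj₁ e = inj₂ (trans (%-distribˡ-* 2 (2 ^ a) 3) (cong (λ r → (2 * r) % 3) e))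
... | inj₂ e = inj₁ (trans (%-distribˡ-* 2 (2 ^ a) 3) (cong (λ r → (2 * r) % 3) e))

-- In the coordinate Y(x) = x + 2c + 1 (mod 4c) every letter i
-- has an odd predecessor p → i with Y(p) = 2·Y(i); after M backward steps
-- Y becomes a multiple of 2^M, i.e. one of the three letters h, v₁, v₂ with
-- Y = 0, 2^M, 2^{M+1}.  Those are all reached from h.
module FromHub (t M : ℕ) (2^M≡ : 2 ^ M ≡ 4 * suc t) (E : ℕ → ℕ → Set) (edges : Edges (3 * suc t) E) where
  open Edges edges
  open Walks E

  u c N s : ℕ
  u = suc t
  c = 3 * u
  N = 4 * c
  s = suc (c + c)

  c≡ : c ≡ suc (3 * t + 2)
  c≡ = lemma t where
    lemma : ∀ t → 3 * suc t ≡ suc (3 * t + 2)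
    lemma = solve-∀

  2≤c : 2 ≤ c
  2≤c = subst (2 ≤_) (sym c≡) (s≤s (≤-trans (s≤s z≤n) (m≤n+m 2 (3 * t))))

  open ToHub c (3 * t + 2) c≡ 2≤c E edges public using (h; hub-loop; to-hub)

  Y : ℕ → ℕ
  Y x = (x + s) % N

  -- Y is a bijection of [0, 4c): its inverse is y ↦ y + h (mod 4c), as s + h = 4c.
  Y-inverse : ∀ x → x < N → (Y x + h) % N ≡ x
  Y-inverse x x< = begin
    ((x + s) % N + h) % N      ≡⟨ %-distribˡ-+ ((x + s) % N) h N ⟩
    ((x + s) % N % N + h % N) % N ≡⟨ cong (λ r → (r + h % N) % N) (m%n%n≡m%n (x + s) N) ⟩
    ((x + s) % N + h % N) % N  ≡⟨ sym (%-distribˡ-+ (x + s) h N) ⟩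
    (x + s + h) % N            ≡⟨ cong (_% N) (lemma x t) ⟩
    (x + 1 * N) % N            ≡⟨ [m+kn]%n≡m%n x 1 N ⟩
    x % N                      ≡⟨ m<n⇒m%n≡m x< ⟩
    x                          ∎
    where
      open ≡-Reasoning
      lemma : ∀ x t → x + suc (3 * suc t + 3 * suc t) + (3 * suc t + (3 * t + 2)) ≡ x + 1 * (4 * (3 * suc t))
      lemma = solve-∀

  Y-injective : ∀ x y → x < N → y < N → Y x ≡ Y y → x ≡ y
  Y-injective x y x< y< Yx≡Yy = trans (sym (Y-inverse x x<)) (trans (cong (λ r → (r + h) % N) Yx≡Yy) (Y-inverse y y<))

  Y-double : ∀ i p w → 2 * (i + s) ≡ (p + s) + w * N → Y p ≡ (2 * Y i) % N
  Y-double i p w e = begin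
    (p + s) % N            ≡⟨ sym ([m+kn]%n≡m%n (p + s) w N) ⟩
    ((p + s) + w * N) % N  ≡⟨ cong (_% N) (sym e) ⟩
    (2 * (i + s)) % N      ≡⟨ sym (double-mod (i + s) N) ⟩
    (2 * Y i) % N          ∎
    where open ≡-Reasoning

  data Region (i : ℕ) : Set where
    bottom : i < c → Region i
    middle : ∀ d → d < c + c → i ≡ c + d → Region i
    top    : ∀ d → d < c → i ≡ c + ((c + c) + d) → Region i

  N≡3c+c : N ≡ (c + (c + c)) + c
  N≡3c+c = lemma c where
    lemma : ∀ x → 4 * x ≡ (x + (x + x)) + x
    lemma = solve-∀

  region : ∀ i → i < N → Region i
  region i i< with i <? c | i <? c + (c + c)
  ... | yes i<c | _        = bottom i<c
  ... | no i≮c  | yes i<3c = middle d (+-cancelˡ-< c d (c + c) (subst (_< c + (c + c)) i≡ i<3c)) i≡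
    where
      d : ℕ
      d = i ∸ c
      i≡ : i ≡ c + d
      i≡ = sym (m+[n∸m]≡n (≮⇒≥ i≮c))
  ... | no _    | no i≮3c  = top d (+-cancelˡ-< (c + (c + c)) d c (subst₂ _<_ i≡ N≡3c+c i<)) (trans i≡ (+-assoc c (c + c) d))
    where
      d : ℕ
      d = i ∸ (c + (c + c))
      i≡ : i ≡ (c + (c + c)) + d
      i≡ = sym (m+[n∸m]≡n (≮⇒≥ i≮3c))

  odd-below : ∀ d → d < c + c → suc (d + d) < N
  odd-below d d< = subst₂ _≤_ (cong suc (+-suc d d)) (sym (quadruple c)) (+-mono-≤ d< d<)

  predecessor : ∀ i → i < N → Σ ℕ (λ p → p < N × E p i × Y p ≡ (2 * Y i) % N)
  predecessor i i< with region i i<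
  ... | bottom i<c = p , p< , G-edge-high p i p< (inj₂ (inj₂ (c + i , refl))) (half-odd (c + i)) ,
                     Y-double i p 0 (lemma c i)
    where
      p : ℕ
      p = suc ((c + i) + (c + i))
      p< : p < N
      p< = odd-below (c + i) (+-monoʳ-< c i<c)
      lemma : ∀ c i → 2 * (i + suc (c + c)) ≡ (suc ((c + i) + (c + i)) + suc (c + c)) + 0 * (4 * c)
      lemma = solve-∀
  ... | middle d d< refl = p , p< , subst (E p) (cong (c +_) (half-odd d)) (F-edge p p< (inj₂ (d , refl))) ,
                           Y-double (c + d) p 1 (lemma c d)
    where
      p : ℕ
      p = suc (d + d)
      p< : p < N
      p< = odd-below d d<
      lemma : ∀ c d → 2 * ((c + d) + suc (c + c)) ≡ (suc (d + d) + suc (c + c)) + 1 * (4 * c)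
      lemma = solve-∀
  ... | top d d< refl = p , p< ,
                        subst (λ q → E p (c + ((c + c) + q))) (half-odd d)
                          (G-edge-low p p< (inj₂ (inj₂ (d , refl))) (subst (_< c) (sym (half-odd d)) d<)) ,
                        Y-double (c + ((c + c) + d)) p 2 (lemma c d)
    where
      p : ℕ
      p = suc (d + d)
      p< : p < N
      p< = odd-below d (<-≤-trans d< (m≤m+n c c))
      lemma : ∀ c d → 2 * ((c + ((c + c) + d)) + suc (c + c)) ≡ (suc (d + d) + suc (c + c)) + 2 * (4 * c)
      lemma = solve-∀

  ancestor : ∀ n i → i < N → Σ ℕ (λ p → p < N × Reach p i × Y p ≡ (2 ^ n * Y i) % N)
  ancestor zero    i i< = i , i< , (0 , []) , trans (sym (m%n%n≡m%n (i + s) N)) (cong (_% N) (sym (*-identityˡ (Y i))))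
  ancestor (suc n) i i< with ancestor n i i<
  ... | p , p< , p⇝i , Yp with predecessor p p<
  ...   | p′ , p′< , p′→p , Yp′ = p′ , p′< , (edge p′→p then p⇝i) , (begin
    Y p′                          ≡⟨ Yp′ ⟩
    (2 * Y p) % N                 ≡⟨ cong (λ r → (2 * r) % N) Yp ⟩
    (2 * ((2 ^ n * Y i) % N)) % N ≡⟨ double-mod (2 ^ n * Y i) N ⟩
    (2 * (2 ^ n * Y i)) % N       ≡⟨ cong (_% N) (sym (*-assoc 2 (2 ^ n) (Y i))) ⟩
    (2 ^ suc n * Y i) % N         ∎)
    where open ≡-Reasoning

  -- Since 4c = 3·2^M, multiplying by 2^M modulo 4c only remembers the residue mod 3.
  collapse : ∀ y → (2 ^ M * y) % N ≡ (y % 3) * (4 * u)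
  collapse y = begin
    (2 ^ M * y) % N               ≡⟨ cong (λ r → (r * y) % N) 2^M≡ ⟩
    ((4 * u) * y) % N             ≡⟨ cong (_% N) (*-comm (4 * u) y) ⟩
    (y * (4 * u)) % N             ≡⟨ %-congʳ {o = y * (4 * u)} (lemma u) ⟩
    (y * (4 * u)) % (3 * (4 * u)) ≡⟨ sym (m%n*o≡m*o%[n*o] y 3 (4 * u)) ⟩
    (y % 3) * (4 * u)             ∎
    where
      open ≡-Reasoning
      lemma : ∀ u → 4 * (3 * u) ≡ 3 * (4 * u)
      lemma = solve-∀

  hub-ancestor : ∀ x → x < N → Σ ℕ (λ p → p < N × Reach p x × Y p ≡ (Y x % 3) * (4 * u))
  hub-ancestor x x< with ancestor M x x<
  ... | p , p< , p⇝x , Yp = p , p< , p⇝x , trans Yp (collapse (Y x))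

  below-N : ∀ y r → suc y + r ≡ N → y < N
  below-N y r e = subst (suc y ≤_) e (m≤m+n (suc y) r)

  Y-value : ∀ x y k → x + s ≡ y + k * N → y < N → Y x ≡ y
  Y-value x y k e y< = trans (cong (_% N) e) (trans ([m+kn]%n≡m%n y k N) (m<n⇒m%n≡m y<))

  -- The letters with Y = 0, 2^M, 2^{M+1}, and two letters e₁, e₂ with edges e₁ → v₁, e₂ → v₂.
  v₁ v₂ e₁ e₂ : ℕ
  v₁ = c + ((c + c) + t)
  v₂ = suc (t + t)
  e₁ = t + t
  e₂ = (5 * t + 4) + (5 * t + 4)

  h<N : h < N
  h<N = below-N h (6 * t + 6) (lemma t) where
    lemma : ∀ t → suc (3 * suc t + (3 * t + 2)) + (6 * t + 6) ≡ 4 * (3 * suc t)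
    lemma = solve-∀

  v₁<N : v₁ < N
  v₁<N = below-N v₁ (2 * t + 2) (lemma t) where
    lemma : ∀ t → suc (3 * suc t + ((3 * suc t + 3 * suc t) + t)) + (2 * t + 2) ≡ 4 * (3 * suc t)
    lemma = solve-∀

  v₂<N : v₂ < N
  v₂<N = below-N v₂ (10 * t + 10) (lemma t) where
    lemma : ∀ t → suc (suc (t + t)) + (10 * t + 10) ≡ 4 * (3 * suc t)
    lemma = solve-∀

  e₁<c : e₁ < c
  e₁<c = subst (suc e₁ ≤_) (lemma t) (m≤m+n (suc e₁) (t + 2)) where
    lemma : ∀ t → suc (t + t) + (t + 2) ≡ 3 * suc t
    lemma = solve-∀

  e₂<N : e₂ < N
  e₂<N = below-N e₂ (2 * t + 3) (lemma t) where
    lemma : ∀ t → suc ((5 * t + 4) + (5 * t + 4)) + (2 * t + 3) ≡ 4 * (3 * suc t)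
    lemma = solve-∀

  Y-h : Y h ≡ 0
  Y-h = Y-value h 0 1 (lemma t) (≤-trans (s≤s z≤n) h<N) where
    lemma : ∀ t → (3 * suc t + (3 * t + 2)) + suc (3 * suc t + 3 * suc t) ≡ 0 + 1 * (4 * (3 * suc t))
    lemma = solve-∀

  2^M<N : 1 * (4 * u) < N
  2^M<N = below-N _ (8 * t + 7) (lemma t) where
    lemma : ∀ t → suc (1 * (4 * suc t)) + (8 * t + 7) ≡ 4 * (3 * suc t)
    lemma = solve-∀

  2^M⁺¹<N : 2 * (4 * u) < N
  2^M⁺¹<N = below-N _ (4 * t + 3) (lemma t) where
    lemma : ∀ t → suc (2 * (4 * suc t)) + (4 * t + 3) ≡ 4 * (3 * suc t)
    lemma = solve-∀

  Y-v₁ : Y v₁ ≡ 1 * (4 * u)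
  Y-v₁ = Y-value v₁ (1 * (4 * u)) 1 (lemma t) 2^M<N where
    lemma : ∀ t → (3 * suc t + ((3 * suc t + 3 * suc t) + t)) + suc (3 * suc t + 3 * suc t)
                ≡ 1 * (4 * suc t) + 1 * (4 * (3 * suc t))
    lemma = solve-∀

  Y-v₂ : Y v₂ ≡ 2 * (4 * u)
  Y-v₂ = Y-value v₂ (2 * (4 * u)) 0 (lemma t) 2^M⁺¹<N where
    lemma : ∀ t → suc (t + t) + suc (3 * suc t + 3 * suc t) ≡ 2 * (4 * suc t) + 0 * (4 * (3 * suc t))
    lemma = solve-∀

  Y-e₁ : Y e₁ ≡ 8 * t + 7
  Y-e₁ = Y-value e₁ (8 * t + 7) 0 (lemma t) (below-N _ (4 * t + 4) (lemma′ t)) where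
    lemma : ∀ t → (t + t) + suc (3 * suc t + 3 * suc t) ≡ (8 * t + 7) + 0 * (4 * (3 * suc t))
    lemma = solve-∀
    lemma′ : ∀ t → suc (8 * t + 7) + (4 * t + 4) ≡ 4 * (3 * suc t)
    lemma′ = solve-∀

  Y-e₂ : Y e₂ ≡ 4 * t + 3
  Y-e₂ = Y-value e₂ (4 * t + 3) 1 (lemma t) (below-N _ (8 * t + 8) (lemma′ t)) where
    lemma : ∀ t → ((5 * t + 4) + (5 * t + 4)) + suc (3 * suc t + 3 * suc t) ≡ (4 * t + 3) + 1 * (4 * (3 * suc t))
    lemma = solve-∀
    lemma′ : ∀ t → suc (4 * t + 3) + (8 * t + 8) ≡ 4 * (3 * suc t)
    lemma′ = solve-∀

  e₁→v₁ : E e₁ v₁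
  e₁→v₁ = subst (λ q → E e₁ (c + ((c + c) + q))) (sym (n≡⌊n+n/2⌋ t))
            (G-edge-low e₁ (<-≤-trans e₁<c (m≤n*m c 4)) (inj₁ e₁<c)
                        (subst (_< c) (n≡⌊n+n/2⌋ t) (≤-<-trans (m≤m+n t t) e₁<c)))

  e₂→v₂ : E e₂ v₂
  e₂→v₂ = G-edge-high e₂ v₂ e₂<N (inj₂ (inj₁ 2c≤e₂)) (trans (sym (n≡⌊n+n/2⌋ (5 * t + 4))) (lemma t))
    where
      lemma : ∀ t → 5 * t + 4 ≡ 3 * suc t + suc (t + t)
      lemma = solve-∀
      2c≤e₂ : c + c ≤ e₂
      2c≤e₂ = subst (c + c ≤_) (lemma′ t) (m≤m+n (c + c) (4 * t + 2)) where
        lemma′ : ∀ t → (3 * suc t + 3 * suc t) + (4 * t + 2) ≡ (5 * t + 4) + (5 * t + 4)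
        lemma′ = solve-∀

  -- v₁ and v₂ are each other's predecessors: Y(v₂) = 2·Y(v₁) and Y(v₁) ≡ 2·Y(v₂) (mod 4c).
  v₂→v₁ : E v₂ v₁
  v₂→v₁ with predecessor v₁ v₁<N
  ... | p , p< , p→v₁ , Yp = subst (λ x → E x v₁) (Y-injective p v₂ p< v₂<N Yp≡) p→v₁
    where
      Yp≡ : Y p ≡ Y v₂
      Yp≡ = trans Yp (trans (cong (λ y → (2 * y) % N) Y-v₁)
                     (trans (cong (_% N) (lemma u)) (trans (m<n⇒m%n≡m 2^M⁺¹<N) (sym Y-v₂))))
        where
          lemma : ∀ u → 2 * (1 * (4 * u)) ≡ 2 * (4 * u)
          lemma = solve-∀

  v₁→v₂ : E v₁ v₂
  v₁→v₂ with predecessor v₂ v₂<N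
  ... | p , p< , p→v₂ , Yp = subst (λ x → E x v₂) (Y-injective p v₁ p< v₁<N Yp≡) p→v₂
    where
      Yp≡ : Y p ≡ Y v₁
      Yp≡ = trans Yp (trans (cong (λ y → (2 * y) % N) Y-v₂)
                     (trans (cong (_% N) (lemma u)) (trans ([m+kn]%n≡m%n (1 * (4 * u)) 1 N)
                       (trans (m<n⇒m%n≡m 2^M<N) (sym Y-v₁)))))
        where
          lemma : ∀ u → 2 * (2 * (4 * u)) ≡ 1 * (4 * u) + 1 * (4 * (3 * u))
          lemma = solve-∀

  -- A letter x with Y(x) ≡ 0 (mod 3) is reached from h, as its M-th ancestor has Y = 0.
  hub-reaches-multiple : ∀ x → x < N → Y x % 3 ≡ 0 → Reach h x
  hub-reaches-multiple x x< Yx%3 with hub-ancestor x x<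
  ... | p , p< , p⇝x , Yp = subst (λ q → Reach q x) (Y-injective p h p< h<N (trans Yp (trans (cong (_* (4 * u)) Yx%3) (sym Y-h)))) p⇝x

  -- Depending on 2^M mod 3, one of e₁, e₂ has Y ≡ 0 (mod 3); either way h reaches v₁ and v₂.
  hub-reaches-v : Reach h v₁ × Reach h v₂
  hub-reaches-v with pow2-mod3 M
  ... | inj₁ 2^M%3≡1 = (h⇝v₂ then edge v₂→v₁) , h⇝v₂
    where
      Ye₂%3 : Y e₂ % 3 ≡ 0
      Ye₂%3 = trans (cong (_% 3) Y-e₂)
                    (pred-multiple (4 * t + 3) (trans (cong (_% 3) (lemma t)) (subst (λ x → x % 3 ≡ 1) 2^M≡ 2^M%3≡1)))
        where
          lemma : ∀ t → suc (4 * t + 3) ≡ 4 * suc t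
          lemma = solve-∀
      h⇝v₂ : Reach h v₂
      h⇝v₂ = hub-reaches-multiple e₂ e₂<N Ye₂%3 then edge e₂→v₂
  ... | inj₂ 2^M%3≡2 = h⇝v₁ , (h⇝v₁ then edge v₁→v₂)
    where
      Ye₁%3 : Y e₁ % 3 ≡ 0
      Ye₁%3 = trans (cong (_% 3) Y-e₁) (pred-multiple (8 * t + 7) (trans (cong (_% 3) (lemma t)) 8u%3≡1))
        where
          lemma : ∀ t → suc (8 * t + 7) ≡ 2 * (4 * suc t)
          lemma = solve-∀
          8u%3≡1 : (2 * (4 * u)) % 3 ≡ 1
          8u%3≡1 = trans (%-distribˡ-* 2 (4 * u) 3) (cong (λ r → (2 * r) % 3) (subst (λ x → x % 3 ≡ 2) 2^M≡ 2^M%3≡2))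
      h⇝v₁ : Reach h v₁
      h⇝v₁ = hub-reaches-multiple e₁ (<-≤-trans e₁<c (m≤n*m c 4)) Ye₁%3 then edge e₁→v₁

  -- Every letter i is reached from h through its M-th ancestor, which is h, v₁ or v₂.
  from-hub : ∀ i → i < N → Reach h i
  from-hub i i< with Y i % 3 | m%n<n (Y i) 3 | hub-ancestor i i<
  ... | 0 | _ | p , p< , p⇝i , Yp = subst (λ q → Reach q i) (Y-injective p h p< h<N (trans Yp (sym Y-h))) p⇝i
  ... | 1 | _ | p , p< , p⇝i , Yp = proj₁ hub-reaches-v then subst (λ q → Reach q i) (Y-injective p v₁ p< v₁<N (trans Yp (sym Y-v₁))) p⇝i
  ... | 2 | _ | p , p< , p⇝i , Yp = proj₂ hub-reaches-v then subst (λ q → Reach q i) (Y-injective p v₂ p< v₂<N (trans Yp (sym Y-v₂))) p⇝i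
  ... | suc (suc (suc _)) | s≤s (s≤s (s≤s ())) | _

level-size : ∀ k → length (listing (suc k)) ≡ 4 * width k
level-size k = trans (Positions.ws-length k) (sym (quadruple (width k)))

eta-edges : ∀ k → let ws = listing (suc k) in
            Edges (width k) (Edge (length ws) (Eta.η (suc (suc k)) ws))
eta-edges k = record
  { F-edge      = λ v v< cond → below v< , subst (_∈ η v) (F-formula v (below v<)) (F∈η v v< cond)
  ; G-edge-low  = λ v v< cond q< → below v< , subst (_∈ η v) (G-formula-low v q<) (G∈η v v< cond)
  ; G-edge-high = λ v q v< cond q≡ → below v< , subst (_∈ η v) (G-formula-high v q q≡ (q< v q v< q≡)) (G∈η v v< cond)
  }
  where
    open Positions k
    open Eta (suc (suc k)) ws using (η)
    L≡ : length ws ≡ 4 * c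
    L≡ = level-size k
    open EtaLetters (suc (suc k)) ws c L≡
    below : ∀ {v} → v < 4 * c → v < length ws
    below {v} = subst (v <_) (sym L≡)
    q< : ∀ v q → v < 4 * c → ⌊ v /2⌋ ≡ c + q → q < c
    q< v q v< q≡ = +-cancelˡ-< c q c (subst (_< c + c) q≡ (half-< v (c + c) (subst (v <_) (trans (sym L≡) ws-length) v<)))

power-of-two : ∀ k → Σ ℕ (λ t → 2 ^ k ≡ suc t)
power-of-two k with 2 ^ k | m^n>0 2 k
... | suc t | _ = t , refl

proposition7 : (m : ℕ) → 3 ≤ m → (ws : List Word) → IsLexListing m ws →
                 Primitive (etaMatrix m ws)
proposition7 (suc (suc k)) (s≤s (s≤s _)) ws lex with lexListing≡listing (suc k) ws lex | power-of-two k
... | refl | t , 2^k≡ = hub⇒primitive (length ws) η h hub-loop to-hub′ from-hub′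
  where
    open Eta (suc (suc k)) ws using (η)
    E : ℕ → ℕ → Set
    E = Edge (length ws) η
    open Walks E using (Reach)
    width≡ : width k ≡ 3 * suc t
    width≡ = cong (3 *_) 2^k≡
    2^M≡ : 2 ^ suc (suc k) ≡ 4 * suc t
    2^M≡ = trans (sym (*-assoc 2 2 (2 ^ k))) (cong (4 *_) 2^k≡)
    open FromHub t (suc (suc k)) 2^M≡ E (subst (λ c → Edges c E) width≡ (eta-edges k)) using (h; hub-loop; to-hub; from-hub)
    L≡ : length ws ≡ 4 * (3 * suc t)
    L≡ = trans (level-size k) (cong (4 *_) width≡)
    to-hub′ : ∀ j → j < length ws → Reach j h
    to-hub′ j j< = to-hub j (subst (j <_) L≡ j<)
    from-hub′ : ∀ i → i < length ws → Reach h i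
    from-hub′ i i< = from-hub i (subst (i <_) L≡ i<)
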